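{- Let $\mathbb{F}_q$ be a finite field, $P,Q\in\mathbb{F}_q[X]\setminus\{0\}$ coprime with $\deg P>\deg Q$, $\mathcal{D}=\{s\in\mathbb{F}_q[X]:\deg s<\deg P\}$, and let $W_{P/Q}$ be the $\omega$-language of the expansion graph $T(P/Q)$. Then every $\alpha\in\mathbb{F}_q((X^{ -1}))$ has a unique $P/Q$-digit expansion, i.e. there exist $k\ge0$ and digits $s_k,\dots,s_0,s_{ -1},s_{ -2},\dots\in\mathcal{D}$ with $s_ks_{k-1}\cdots s_0s_{ -1}s_{ -2}\cdots\in W_{P/Q}$ and \[ \alpha=\sum_{i=-\infty}^{k}\frac{s_i}{Q}\Big(\frac{P}{Q}\Big)^i, \] and any two such expansions of $\alpha$ have the same digits $s_i$ for all $i$ (digits of index above the respective top index being taken as $0$).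
   Context: $\mathbb{F}_q((X^{ -1}))$ is the field of formal Laurent series $\sum_{i\le h}\alpha_iX^i$ with absolute value $|\alpha|=q^{\deg\alpha}$ ($|0|=0$), and the series above converges with respect to this absolute value. The expansion graph $T(P/Q)$ is the edge-labelled directed graph with vertex set $\mathbb{F}_q[X]$ in which there is an edge from $v$ to $w$ with label $s\in\mathcal{D}$ whenever $w=(Pv+s)/Q\in\mathbb{F}_q[X]$; $W_{P/Q}$ is the set of right-infinite words over $\mathcal{D}$ that are label sequences of infinite directed paths starting at the vertex $0$ (so prepending zeros to a word of $W_{P/Q}$ keeps it in $W_{P/Q}$, via the loop at $0$). -}

module Defs where

open import Data.Nat as ℕ using (ℕ; zero; suc)
open import Data.Integer as ℤ using (ℤ; +_; -[1+_])
open import Data.Fin using (Fin)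
open import Data.List as List using (List; []; _∷_; length)
open import Data.Product using (Σ; ∃; _×_; _,_)
open import Function.Bundles using (_↔_)
open import Relation.Binary.PropositionalEquality using (_≡_; _≢_)
open import Algebra.Structures using (IsCommutativeRing)

record FiniteField : Set₁ where
  infixl 6 _+_
  infixl 7 _*_
  field
    Carrier : Set
    _+_ _*_ : Carrier → Carrier → Carrier
    -_ : Carrier → Carrier
    0# 1# : Carrier
    isCommutativeRing : IsCommutativeRing _≡_ _+_ _*_ -_ 0# 1#
    inv : (x : Carrier) → x ≢ 0# → Carrier
    inv-correct : (x : Carrier) (p : x ≢ 0#) → x * inv x p ≡ 1#
    0≢1 : 0# ≢ 1#
    size : ℕ
    enum : Fin size ↔ Carrier

module _ (F : FiniteField) where
  open FiniteField F

  -- Polynomials F_q[X]: coefficient lists, lowest degree first.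
  -- Equality of polynomials is coefficientwise (trailing zeros ignored).

  Poly : Set
  Poly = List Carrier

  coeff : Poly → ℕ → Carrier
  coeff []       _       = 0#
  coeff (a ∷ _)  zero    = a
  coeff (_ ∷ as) (suc n) = coeff as n

  _≈P_ : Poly → Poly → Set
  A ≈P B = ∀ n → coeff A n ≡ coeff B n

  sumF : ℕ → (ℕ → Carrier) → Carrier
  sumF zero    f = 0#
  sumF (suc n) f = sumF n f + f n

  tab : ℕ → (ℕ → Carrier) → Poly
  tab n f = List.map f (List.upTo n)

  addP : Poly → Poly → Poly
  addP A B = tab (length A ℕ.+ length B) (λ n → coeff A n + coeff B n)

  mulP : Poly → Poly → Poly
  mulP A B = tab (length A ℕ.+ length B)
    (λ n → sumF (suc n) (λ i → coeff A i * coeff B (n ℕ.∸ i)))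

  powP : Poly → ℕ → Poly
  powP A zero    = 1# ∷ []
  powP A (suc m) = mulP A (powP A m)

  HasDegree : Poly → ℕ → Set
  HasDegree P d = (coeff P d ≢ 0#) × (∀ n → d ℕ.< n → coeff P n ≡ 0#)

  -- s ∈ 𝒟 = { s : deg s < deg P }, where dP = deg P
  InDigits : ℕ → Poly → Set
  InDigits dP s = ∀ n → dP ℕ.≤ n → coeff s n ≡ 0#

  Divides : Poly → Poly → Set
  Divides D A = ∃ λ E → mulP D E ≈P A

  Coprime : Poly → Poly → Set
  Coprime P Q = ∀ D → Divides D P → Divides D Q → Divides D (1# ∷ [])

  Edge : (P Q : Poly) (dP : ℕ) → Poly → Poly → Poly → Set
  Edge P Q dP v s w = InDigits dP s × (mulP Q w ≈P addP (mulP P v) s)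

  InW : (P Q : Poly) (dP : ℕ) → (ℕ → Poly) → Set
  InW P Q dP word = ∃ λ (v : ℕ → Poly) →
    (v 0 ≈P []) × (∀ n → Edge P Q dP (v n) (word n) (v (suc n)))

  record Laurent : Set where
    field
      lc     : ℤ → Carrier
      top    : ℤ
      vanish : ∀ j → top ℤ.< j → lc j ≡ 0#
  open Laurent public

  embed : Poly → ℤ → Carrier
  embed A (+ n)    = coeff A n
  embed A -[1+ _ ] = 0#

  mulPL : Poly → Laurent → ℤ → Carrier
  mulPL A β j = sumF (length A) (λ n → coeff A n * lc β (j ℤ.- + n))

  -- β = (s/Q)(P/Q)^i, written without division (multiplication by a
  -- nonzero polynomial is injective in the field F_q((X^{-1}))):
  --   i = m ≥ 0    :  Q^{m+1} β = s P^m
  --   i = -(m+1)   :  P^{m+1} β = s Q^m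
  IsTerm : (P Q s : Poly) → ℤ → Laurent → Set
  IsTerm P Q s (+ m)    β = ∀ j → mulPL (powP Q (suc m)) β j ≡ embed (mulP s (powP P m)) j
  IsTerm P Q s -[1+ m ] β = ∀ j → mulPL (powP P (suc m)) β j ≡ embed (mulP s (powP Q m)) j

  -- Σ_n β n converges to α in |·|: for every M, from some N0 on, the
  -- partial sums agree with α in all coefficients of index ≥ -M.
  ConvergesTo : (ℕ → Laurent) → Laurent → Set
  ConvergesTo β α = ∀ (M : ℕ) → ∃ λ N0 → ∀ N → N0 ℕ.≤ N →
    ∀ (j : ℤ) → ℤ.- (+ M) ℤ.≤ j → lc α j ≡ sumF N (λ n → lc (β n) j)

  -- P/Q-digit expansion with top index k and digit word
  -- word n = s_{k-n}  (so word = s_k s_{k-1} ... s_0 s_{-1} ...).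
  IsExpansion : (P Q : Poly) (dP : ℕ) → Laurent → ℕ → (ℕ → Poly) → Set
  IsExpansion P Q dP α k word =
    InW P Q dP word ×
    (∃ λ (β : ℕ → Laurent) →
       (∀ n → IsTerm P Q (word n) (+ k ℤ.- + n) (β n)) × ConvergesTo β α)

  digitAt : ℕ → (ℕ → Poly) → ℤ → Poly
  digitAt k word i with + k ℤ.- i
  ... | + n      = word n
  ... | -[1+ _ ] = []

-- A Laurent series is handled through its coefficient function ℤ → F_q
-- (a "sequence"), and a polynomial A acts on sequences by convolution,
-- A · s.  Three facts about this action carry the proof: it is an action
-- of the commutative ring F_q[X] ((A B) · s = A · (B · s)); multiplying a
-- sequence vanishing above t by a polynomial of degree d gives one whose
-- coefficient at t + d is the product of the leading coefficients, so
-- degrees add and the action is injective on bounded sequences; and a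
-- bounded sequence can be divided by any nonzero polynomial (long division).
--
-- Write (P/Q)^t = num t / den t for t ∈ ℤ and e = deg P - deg Q ≥ 1.  A
-- level-t approximation of α is a pair (W, Z) of a polynomial W and a
-- bounded sequence Z with den t · Z = num t · W (that is, Z = W (P/Q)^t)
-- and α - Z vanishing above t e - 1.  Existence: dividing den t · α by
-- num t and keeping the polynomial part W t gives such a pair for every t;
-- the words Q W t - P W (t + 1) label a path of T(P/Q) from 0 and the
-- differences of consecutive approximations are the terms of the
-- expansion, which telescope to α.  Uniqueness: the polynomial part of a
-- level approximation is unique, and the partial sums of any expansion are
-- level approximations whose polynomial parts are the vertices of its
-- path; hence every digit Q W i - P W (i + 1) is determined by α.
module Submission where

open import Defs
open import Algebra.Bundles using (CommutativeRing)
open import Relation.Binary.PropositionalEquality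
open import Data.Maybe using (nothing)
open import Relation.Nullary using (yes; no)
open import Data.Empty using (⊥-elim)
open import Function using (_∘_)
open import Data.Sum using (inj₁; inj₂)
open import Data.Product using (Σ-syntax; ∃; _,_; proj₁; proj₂; _×_)
open import Data.Nat as ℕ using (ℕ; zero; suc; z≤n; s≤s; _≤_; _<_; _∸_)
import Data.Nat.Properties as ℕP
open import Data.List as List using (List; []; _∷_; length; applyUpTo)
import Data.List.Properties as ListP
open import Data.Integer as ℤ using (ℤ; -[1+_]) renaming (+_ to ⁺_)
import Data.Integer.Properties as ℤP
open import Data.Integer.Tactic.RingSolver using () renaming (solve-∀ to ℤ-solve)
import Tactic.RingSolver.Core.AlmostCommutativeRing as ACR

module Development (F : FiniteField) where
  open FiniteField F

  CR : CommutativeRing _ _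
  CR = record { isCommutativeRing = isCommutativeRing }

  open CommutativeRing CR
    using (+-assoc; +-comm; *-comm; *-assoc; +-identityʳ; +-identityˡ; zeroˡ; zeroʳ;
           distribˡ; *-identityˡ; -‿inverseʳ)
  open import Algebra.Properties.Ring (CommutativeRing.ring CR)
    using (-‿distribʳ-*; -0#≈0#; -‿involutive)
  open import Algebra.Properties.AbelianGroup (CommutativeRing.+-abelianGroup CR)
    using (⁻¹-∙-comm; x∙y⁻¹≈ε⇒x≈y)
  open import Tactic.RingSolver.NonReflective (ACR.fromCommutativeRing CR (λ _ → nothing))
    using (solve; _⊜_; _⊕_; ⊝_)

  add-sub-cancel : ∀ s u → s + (u + - s) ≡ u
  add-sub-cancel s u = begin
      s + (u + - s)
    ≡⟨ solve 2 (λ s u → (s ⊕ (u ⊕ (⊝ s))) ⊜ (u ⊕ (s ⊕ (⊝ s)))) refl s u ⟩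
      u + (s + - s)
    ≡⟨ cong (u +_) (-‿inverseʳ s) ⟩
      u + 0#
    ≡⟨ +-identityʳ u ⟩
      u ∎
    where open ≡-Reasoning

  sub-from-sum : ∀ a b c → a ≡ b + c → a + - b ≡ c
  sub-from-sum a b c e = trans (cong (_+ - b) e) (trans (+-assoc b c (- b)) (add-sub-cancel b c))

  sub≡0⇒≡ : ∀ a b → a + - b ≡ 0# → a ≡ b
  sub≡0⇒≡ = x∙y⁻¹≈ε⇒x≈y

  sub-sub-cancel : ∀ a b c → (a + - c) + - (a + - b) ≡ b + - c
  sub-sub-cancel a b c = begin
      (a + - c) + - (a + - b)
    ≡⟨ cong ((a + - c) +_) (trans (sym (⁻¹-∙-comm a (- b))) (trans (cong (- a +_) (-‿involutive b)) (+-comm _ _))) ⟩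
      (a + - c) + (b + - a)
    ≡⟨ telescope a b c ⟩
      b + - c ∎
    where
    open ≡-Reasoning
    telescope : ∀ a b c → (a + - c) + (b + - a) ≡ b + - c
    telescope a b c = trans (solve 3 (λ a b c → ((a ⊕ (⊝ c)) ⊕ (b ⊕ (⊝ a))) ⊜ (a ⊕ ((b ⊕ (⊝ c)) ⊕ (⊝ a)))) refl a b c)
                            (add-sub-cancel _ _)

  0-0≡0 : 0# + - 0# ≡ 0#
  0-0≡0 = trans (cong (0# +_) -0#≈0#) (+-identityʳ 0#)

  nonzero-*-cancel : ∀ a b → a ≢ 0# → a * b ≡ 0# → b ≡ 0#
  nonzero-*-cancel a b a≢0 ab≡0 = begin
      b
    ≡⟨ sym (*-identityˡ b) ⟩
      1# * b
    ≡⟨ cong (_* b) (sym (inv-correct a a≢0)) ⟩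
      (a * inv a a≢0) * b
    ≡⟨ trans (cong (_* b) (*-comm a (inv a a≢0))) (*-assoc _ _ _) ⟩
      inv a a≢0 * (a * b)
    ≡⟨ cong (inv a a≢0 *_) ab≡0 ⟩
      inv a a≢0 * 0#
    ≡⟨ zeroʳ _ ⟩
      0# ∎
    where open ≡-Reasoning

  *-nonzero : ∀ a b → a ≢ 0# → b ≢ 0# → a * b ≢ 0#
  *-nonzero a b a≢0 b≢0 ab≡0 = b≢0 (nonzero-*-cancel a b a≢0 ab≡0)

  ∑ = sumF F

  ∑-cong : ∀ N {f g} → (∀ n → n < N → f n ≡ g n) → ∑ N f ≡ ∑ N g
  ∑-cong zero h = refl
  ∑-cong (suc N) h = cong₂ _+_ (∑-cong N (λ n p → h n (ℕP.m≤n⇒m≤1+n p))) (h N ℕP.≤-refl)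

  ∑-zero : ∀ N {f} → (∀ n → n < N → f n ≡ 0#) → ∑ N f ≡ 0#
  ∑-zero zero h = refl
  ∑-zero (suc N) h = trans (cong₂ _+_ (∑-zero N (λ n p → h n (ℕP.m≤n⇒m≤1+n p))) (h N ℕP.≤-refl)) (+-identityʳ 0#)

  ∑-+ : ∀ N f g → ∑ N (λ n → f n + g n) ≡ ∑ N f + ∑ N g
  ∑-+ zero f g = sym (+-identityʳ 0#)
  ∑-+ (suc N) f g = trans (cong (_+ (f N + g N)) (∑-+ N f g))
    (solve 4 (λ a b c d → ((a ⊕ b) ⊕ (c ⊕ d)) ⊜ ((a ⊕ c) ⊕ (b ⊕ d))) refl (∑ N f) (∑ N g) (f N) (g N))

  ∑-*ˡ : ∀ N c f → c * ∑ N f ≡ ∑ N (λ n → c * f n)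
  ∑-*ˡ zero c f = zeroʳ c
  ∑-*ˡ (suc N) c f = trans (distribˡ c (∑ N f) (f N)) (cong (_+ (c * f N)) (∑-*ˡ N c f))

  ∑-*ʳ : ∀ N c f → ∑ N f * c ≡ ∑ N (λ n → f n * c)
  ∑-*ʳ N c f = trans (*-comm _ c) (trans (∑-*ˡ N c f) (∑-cong N λ n _ → *-comm c (f n)))

  ∑-neg : ∀ N f → - ∑ N f ≡ ∑ N (λ n → - f n)
  ∑-neg zero f = -0#≈0#
  ∑-neg (suc N) f = trans (solve 2 (λ a b → (⊝ (a ⊕ b)) ⊜ ((⊝ a) ⊕ (⊝ b))) refl (∑ N f) (f N))
                          (cong (_+ (- f N)) (∑-neg N f))

  ∑-extend : ∀ K N {f} → (∀ n → K ≤ n → f n ≡ 0#) → K ≤ N → ∑ N f ≡ ∑ K f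
  ∑-extend K zero h z≤n = refl
  ∑-extend K (suc N) {f} h p with K ℕP.≟ suc N
  ... | yes refl = refl
  ... | no K≢1+N = trans (cong₂ _+_ (∑-extend K N h K≤N) (h N K≤N)) (+-identityʳ _)
    where K≤N = ℕP.≤-pred (ℕP.≤∧≢⇒< p K≢1+N)

  ∑-limits : ∀ K N {f} → (∀ n → K ≤ n → f n ≡ 0#) → (∀ n → N ≤ n → f n ≡ 0#) → ∑ N f ≡ ∑ K f
  ∑-limits K N hK hN with ℕP.≤-total K N
  ... | inj₁ K≤N = ∑-extend K N hK K≤N
  ... | inj₂ N≤K = sym (∑-extend N K hN N≤K)

  ∑-shift : ∀ N f → ∑ (suc N) f ≡ f 0 + ∑ N (f ∘ suc)
  ∑-shift zero f = +-comm 0# (f 0)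
  ∑-shift (suc N) f = trans (cong (_+ f (suc N)) (∑-shift N f)) (+-assoc (f 0) _ _)

  ∑-reverse : ∀ N f → ∑ N f ≡ ∑ N (λ i → f (N ∸ suc i))
  ∑-reverse zero f = refl
  ∑-reverse (suc N) f = begin
      ∑ (suc N) f
    ≡⟨ ∑-shift N f ⟩
      f 0 + ∑ N (f ∘ suc)
    ≡⟨ cong (f 0 +_) (∑-reverse N (f ∘ suc)) ⟩
      f 0 + ∑ N (λ i → f (suc (N ∸ suc i)))
    ≡⟨ cong (f 0 +_) (∑-cong N (λ i p → cong f (sym (ℕP.+-∸-assoc 1 p)))) ⟩
      f 0 + ∑ N (λ i → f (N ∸ i))
    ≡⟨ +-comm _ _ ⟩
      ∑ N (λ i → f (N ∸ i)) + f 0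
    ≡⟨ cong (∑ N (λ i → f (N ∸ i)) +_) (cong f (sym (ℕP.n∸n≡0 N))) ⟩
      ∑ (suc N) (λ i → f (suc N ∸ suc i)) ∎
    where open ≡-Reasoning

  ∑-single : ∀ N a {f} → a < N → (∀ n → n < N → n ≢ a → f n ≡ 0#) → ∑ N f ≡ f a
  ∑-single (suc N) a {f} p h with a ℕP.≟ N
  ... | yes refl = trans (cong (_+ f a) (∑-zero N (λ n q → h n (ℕP.m≤n⇒m≤1+n q) (λ e → ℕP.<-irrefl e q))))
                         (+-identityˡ _)
  ... | no a≢N = trans (cong₂ _+_ (∑-single N a (ℕP.≤∧≢⇒< (ℕP.≤-pred p) a≢N) (λ n q → h n (ℕP.m≤n⇒m≤1+n q)))
                                  (h N ℕP.≤-refl (λ e → a≢N (sym e))))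
                       (+-identityʳ _)

  ∑-triangle : ∀ N (g : ℕ → ℕ → Carrier) →
    ∑ N (λ n → ∑ (suc n) (λ i → g i (n ∸ i))) ≡ ∑ N (λ i → ∑ (N ∸ i) (g i))
  ∑-triangle zero g = refl
  ∑-triangle (suc N) g = begin
      ∑ N (λ n → ∑ (suc n) (λ i → g i (n ∸ i))) + (∑ N (λ i → g i (N ∸ i)) + g N (N ∸ N))
    ≡⟨ cong (_+ (∑ N (λ i → g i (N ∸ i)) + g N (N ∸ N))) (∑-triangle N g) ⟩
      ∑ N (λ i → ∑ (N ∸ i) (g i)) + (∑ N (λ i → g i (N ∸ i)) + g N (N ∸ N))
    ≡⟨ solve 3 (λ a b c → (a ⊕ (b ⊕ c)) ⊜ ((a ⊕ b) ⊕ c)) refl _ _ _ ⟩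
      (∑ N (λ i → ∑ (N ∸ i) (g i)) + ∑ N (λ i → g i (N ∸ i))) + g N (N ∸ N)
    ≡⟨ cong₂ _+_ (sym (∑-+ N _ _)) (trans (cong (g N) (ℕP.n∸n≡0 N)) (sym (+-identityˡ _))) ⟩
      ∑ N (λ i → ∑ (N ∸ i) (g i) + g i (N ∸ i)) + (0# + g N 0)
    ≡⟨ cong₂ _+_ (∑-cong N (λ i p → cong (λ m → ∑ m (g i)) (sym (ℕP.+-∸-assoc 1 (ℕP.<⇒≤ p)))))
                 (cong (λ m → ∑ m (g N)) (sym (trans (ℕP.+-∸-assoc 1 (ℕP.≤-refl {N})) (cong suc (ℕP.n∸n≡0 N))))) ⟩
      ∑ N (λ i → ∑ (suc N ∸ i) (g i)) + ∑ (suc N ∸ N) (g N) ∎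
    where open ≡-Reasoning

  Pol = Poly F
  cf = coeff F

  coeff-beyond : ∀ (A : Pol) n → length A ≤ n → cf A n ≡ 0#
  coeff-beyond [] n p = refl
  coeff-beyond (a ∷ A) (suc n) (s≤s p) = coeff-beyond A n p

  coeff-tab-< : ∀ L f n → n < L → cf (tab F L f) n ≡ f n
  coeff-tab-< L f = go L (λ x → x)
    where
    go : ∀ L (g : ℕ → ℕ) n → n < L → cf (List.map f (applyUpTo g L)) n ≡ f (g n)
    go (suc L) g zero p = refl
    go (suc L) g (suc n) (s≤s p) = go L (g ∘ suc) n p

  coeff-tab-≥ : ∀ L f n → L ≤ n → cf (tab F L f) n ≡ 0#
  coeff-tab-≥ L f n p = coeff-beyond (tab F L f) n (subst (_≤ n) (sym length-tab) p)
    where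
    length-tab : length (tab F L f) ≡ L
    length-tab = trans (ListP.length-map f (applyUpTo (λ x → x) L)) (ListP.length-applyUpTo (λ x → x) L)

  coeff-addP : ∀ A B n → cf (addP F A B) n ≡ cf A n + cf B n
  coeff-addP A B n with n ℕP.<? (length A ℕ.+ length B)
  ... | yes p = coeff-tab-< _ _ n p
  ... | no p = trans (coeff-tab-≥ _ _ n L≤n)
     (sym (trans (cong₂ _+_ (coeff-beyond A n (ℕP.≤-trans (ℕP.m≤m+n _ _) L≤n))
                            (coeff-beyond B n (ℕP.≤-trans (ℕP.m≤n+m _ _) L≤n)))
                 (+-identityʳ 0#)))
    where L≤n = ℕP.≮⇒≥ p

  conv : Pol → Pol → ℕ → Carrier
  conv A B n = ∑ (suc n) (λ i → cf A i * cf B (n ∸ i))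

  coeff-mulP : ∀ A B n → cf (mulP F A B) n ≡ conv A B n
  coeff-mulP A B n with n ℕP.<? (length A ℕ.+ length B)
  ... | yes p = coeff-tab-< _ _ n p
  ... | no p = trans (coeff-tab-≥ _ _ n (ℕP.≮⇒≥ p)) (sym (∑-zero (suc n) term-zero))
    where
    term-zero : ∀ i → i < suc n → cf A i * cf B (n ∸ i) ≡ 0#
    term-zero i q with length A ℕP.≤? i
    ... | yes r = trans (cong (_* _) (coeff-beyond A i r)) (zeroˡ _)
    ... | no r = trans (cong (_ *_) (coeff-beyond B (n ∸ i) lenB≤)) (zeroʳ _)
      where
      lenB≤ : length B ≤ n ∸ i
      lenB≤ = ℕP.≤-trans (ℕP.≤-reflexive (sym (ℕP.m+n∸m≡n i (length B))))
                (ℕP.∸-monoˡ-≤ i (ℕP.≤-trans (ℕP.+-monoˡ-≤ (length B) (ℕP.<⇒≤ (ℕP.≰⇒> r))) (ℕP.≮⇒≥ p)))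

  mulP-comm : ∀ A B → _≈P_ F (mulP F A B) (mulP F B A)
  mulP-comm A B n = trans (coeff-mulP A B n) (trans conv-comm (sym (coeff-mulP B A n)))
    where
    conv-comm : conv A B n ≡ conv B A n
    conv-comm = trans (∑-reverse (suc n) _) (∑-cong (suc n) λ i p →
      trans (*-comm _ _) (cong (λ k → cf B k * cf A (n ∸ i)) (ℕP.m∸[m∸n]≡n (ℕP.≤-pred p))))

  mulP-congʳ : ∀ A X Y → _≈P_ F X Y → _≈P_ F (mulP F A X) (mulP F A Y)
  mulP-congʳ A X Y X≈Y j = trans (coeff-mulP A X j)
    (trans (∑-cong (suc j) (λ i _ → cong (cf A i *_) (X≈Y (j ∸ i)))) (sym (coeff-mulP A Y j)))

  mulP-zeroʳ : ∀ A X → _≈P_ F X [] → _≈P_ F (mulP F A X) []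
  mulP-zeroʳ A X X≈0 j = trans (coeff-mulP A X j) (∑-zero (suc j) (λ i _ → trans (cong (cf A i *_) (X≈0 (j ∸ i))) (zeroʳ _)))

  negP : Pol → Pol
  negP A = List.map -_ A

  coeff-negP : ∀ A n → cf (negP A) n ≡ - cf A n
  coeff-negP [] n = sym -0#≈0#
  coeff-negP (a ∷ A) zero = refl
  coeff-negP (a ∷ A) (suc n) = coeff-negP A n

  DegLe : Pol → ℕ → Set
  DegLe A d = ∀ n → d < n → cf A n ≡ 0#

  degLe-length : ∀ A → DegLe A (length A)
  degLe-length A n p = coeff-beyond A n (ℕP.<⇒≤ p)

  ∸-beyond : ∀ {a b i n} → i ≤ a → a ℕ.+ b < n → b < n ∸ i
  ∸-beyond {_} {b} {i} i≤a p =
    ℕP.≤-trans (ℕP.≤-reflexive (sym (ℕP.m+n∸m≡n i (suc b))))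
      (ℕP.∸-monoˡ-≤ i (ℕP.≤-trans (ℕP.≤-reflexive (ℕP.+-suc i b)) (ℕP.≤-trans (s≤s (ℕP.+-monoˡ-≤ b i≤a)) p)))

  mulP-deg : ∀ A B a b → DegLe A a → DegLe B b → DegLe (mulP F A B) (a ℕ.+ b)
  mulP-deg A B a b dA dB n p = trans (coeff-mulP A B n) (∑-zero (suc n) term-zero)
    where
    term-zero : ∀ i → i < suc n → cf A i * cf B (n ∸ i) ≡ 0#
    term-zero i _ with a ℕP.<? i
    ... | yes q = trans (cong (_* _) (dA i q)) (zeroˡ _)
    ... | no q = trans (cong (_ *_) (dB (n ∸ i) (∸-beyond (ℕP.≮⇒≥ q) p))) (zeroʳ _)

  mulP-lead : ∀ A B a b → DegLe A a → DegLe B b → cf (mulP F A B) (a ℕ.+ b) ≡ cf A a * cf B b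
  mulP-lead A B a b dA dB = trans (coeff-mulP A B (a ℕ.+ b))
     (trans (∑-single (suc (a ℕ.+ b)) a (s≤s (ℕP.m≤m+n a b)) term-zero)
            (cong (λ z → cf A a * cf B z) (ℕP.m+n∸m≡n a b)))
    where
    term-zero : ∀ i → i < suc (a ℕ.+ b) → i ≢ a → cf A i * cf B ((a ℕ.+ b) ∸ i) ≡ 0#
    term-zero i _ i≢a with a ℕP.<? i
    ... | yes q = trans (cong (_* _) (dA i q)) (zeroˡ _)
    ... | no q = trans (cong (_ *_) (dB _ (∸-beyond (ℕP.≤∧≢⇒< (ℕP.≮⇒≥ q) i≢a) (ℕP.+-monoˡ-< b ℕP.≤-refl)))) (zeroʳ _)

  powP-deg : ∀ A d → HasDegree F A d → ∀ m → HasDegree F (powP F A m) (m ℕ.* d)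
  powP-deg A d hA zero = (λ e → 0≢1 (sym e)) , λ { (suc n) _ → refl }
  powP-deg A d (lead≢0 , dA) (suc m) with powP-deg A d (lead≢0 , dA) m
  ... | (leadM≢0 , dM) =
    subst (_≢ 0#) (sym (mulP-lead A (powP F A m) d _ dA dM)) (*-nonzero _ _ lead≢0 leadM≢0) ,
    mulP-deg A (powP F A m) d _ dA dM

  Seq = ℤ → Carrier

  infix 4 _≐_
  record _≐_ (s t : Seq) : Set where
    constructor mk≐
    field app : ∀ j → s j ≡ t j
  open _≐_ public

  ≐-refl : ∀ {s} → s ≐ s
  ≐-refl = mk≐ λ j → refl

  ≐-sym : ∀ {s t} → s ≐ t → t ≐ s
  ≐-sym e = mk≐ λ j → sym (app e j)

  ≐-trans : ∀ {s t u} → s ≐ t → t ≐ u → s ≐ u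
  ≐-trans e f = mk≐ λ j → trans (app e j) (app f j)

  module ≐-Reasoning where
    infix  3 _∎
    infixr 2 _≐⟨_⟩_
    infix  1 begin_
    begin_ : ∀ {s t} → s ≐ t → s ≐ t
    begin e = e
    _≐⟨_⟩_ : ∀ s {t u} → s ≐ t → t ≐ u → s ≐ u
    s ≐⟨ e ⟩ f = ≐-trans e f
    _∎ : ∀ s → s ≐ s
    s ∎ = ≐-refl

  infixl 6 _+S_ _-S_
  _+S_ _-S_ : Seq → Seq → Seq
  (s +S t) j = s j + t j
  (s -S t) j = s j + - t j

  0S : Seq
  0S _ = 0#

  +S-cong : ∀ {s s' t t'} → s ≐ s' → t ≐ t' → s +S t ≐ s' +S t'
  +S-cong e f = mk≐ λ j → cong₂ _+_ (app e j) (app f j)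

  -S-cong : ∀ {s s' t t'} → s ≐ s' → t ≐ t' → s -S t ≐ s' -S t'
  -S-cong e f = mk≐ λ j → cong₂ (λ a b → a + - b) (app e j) (app f j)

  extend : (ℕ → Carrier) → Seq
  extend f (⁺ n) = f n
  extend f -[1+ _ ] = 0#

  extend-≤ : ∀ f m n → n ≤ m → extend f (⁺ m ℤ.- ⁺ n) ≡ f (m ∸ n)
  extend-≤ f m n p rewrite ℤP.[+m]-[+n]≡m⊖n m n | ℤP.⊖-≥ p = refl

  extend-< : ∀ f m n → m < n → extend f (⁺ m ℤ.- ⁺ n) ≡ 0#
  extend-< f m n p rewrite ℤP.[+m]-[+n]≡m⊖n m n | ℤP.⊖-< p | ℕP.+-∸-assoc 1 p = refl

  extend-neg : ∀ f z → z ℤ.< ⁺ 0 → extend f z ≡ 0#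
  extend-neg f (⁺ n) (ℤ.+<+ ())
  extend-neg f -[1+ n ] p = refl

  embed≐extend : ∀ B → embed F B ≐ extend (cf B)
  embed≐extend B = mk≐ λ { (⁺ n) → refl ; -[1+ n ] → refl }

  embed-cong : ∀ A B → _≈P_ F A B → embed F A ≐ embed F B
  embed-cong A B e = mk≐ λ { (⁺ n) → e n ; -[1+ n ] → refl }

  embed-addP : ∀ A B → embed F (addP F A B) ≐ embed F A +S embed F B
  embed-addP A B = mk≐ λ { (⁺ n) → coeff-addP A B n ; -[1+ n ] → sym (+-identityʳ 0#) }

  embed-nil : embed F [] ≐ 0S
  embed-nil = mk≐ λ { (⁺ n) → refl ; -[1+ n ] → refl }

  embed-mulP-comm : ∀ A B → embed F (mulP F A B) ≐ embed F (mulP F B A)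
  embed-mulP-comm A B = embed-cong _ _ (mulP-comm A B)

  act : Pol → Seq → Seq
  act A s j = ∑ (length A) (λ n → cf A n * s (j ℤ.- ⁺ n))

  act-upto : ∀ A L s j → (∀ n → L ≤ n → cf A n ≡ 0#) → act A s j ≡ ∑ L (λ n → cf A n * s (j ℤ.- ⁺ n))
  act-upto A L s j h = ∑-limits L (length A) (λ n p → trans (cong (_* _) (h n p)) (zeroˡ _))
                         (λ n p → trans (cong (_* _) (coeff-beyond A n p)) (zeroˡ _))

  act-congˡ : ∀ A B s → _≈P_ F A B → act A s ≐ act B s
  act-congˡ A B s A≈B = mk≐ λ j →
    trans (act-upto A (length B) s j (λ n p → trans (A≈B n) (coeff-beyond B n p)))
          (∑-cong (length B) λ n _ → cong (_* _) (A≈B n))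

  act-congʳ : ∀ A {s t} → s ≐ t → act A s ≐ act A t
  act-congʳ A e = mk≐ λ j → ∑-cong (length A) λ n _ → cong (_ *_) (app e _)

  act-+S : ∀ A s t → act A (s +S t) ≐ act A s +S act A t
  act-+S A s t = mk≐ λ j → trans (∑-cong (length A) (λ n _ → distribˡ _ _ _)) (∑-+ (length A) _ _)

  act--S : ∀ A s t → act A (s -S t) ≐ act A s -S act A t
  act--S A s t = mk≐ λ j → trans (app (act-+S A s (λ i → - t i)) j) (cong (act A s j +_) (act-neg j))
    where
    act-neg : ∀ j → act A (λ i → - t i) j ≡ - act A t j
    act-neg j = trans (∑-cong (length A) (λ n _ → sym (-‿distribʳ-* _ _))) (sym (∑-neg (length A) _))

  act-0S : ∀ A → act A 0S ≐ 0S
  act-0S A = mk≐ λ j → ∑-zero (length A) λ n _ → zeroʳ _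

  act-mulP : ∀ A B s → act (mulP F A B) s ≐ act A (act B s)
  act-mulP A B s = mk≐ λ j → begin
      act (mulP F A B) s j
    ≡⟨ act-upto (mulP F A B) L s j (λ n p → coeff-tab-≥ _ _ n p) ⟩
      ∑ L (λ n → cf (mulP F A B) n * s (j ℤ.- ⁺ n))
    ≡⟨ ∑-cong L (λ n _ → trans (cong (_* _) (coeff-mulP A B n)) (∑-*ʳ (suc n) _ _)) ⟩
      ∑ L (λ n → ∑ (suc n) (λ i → cf A i * cf B (n ∸ i) * s (j ℤ.- ⁺ n)))
    ≡⟨ ∑-cong L (λ n _ → ∑-cong (suc n) λ i p →
         cong (λ k → cf A i * cf B (n ∸ i) * s (j ℤ.- ⁺ k)) (sym (ℕP.m+[n∸m]≡n (ℕP.≤-pred p)))) ⟩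
      ∑ L (λ n → ∑ (suc n) (λ i → g j i (n ∸ i)))
    ≡⟨ ∑-triangle L (g j) ⟩
      ∑ L (λ i → ∑ (L ∸ i) (g j i))
    ≡⟨ ∑-cong L (λ i _ → row j i) ⟩
      ∑ L (λ i → cf A i * act B s (j ℤ.- ⁺ i))
    ≡⟨ sym (act-upto A L (act B s) j (λ n p → coeff-beyond A n (ℕP.≤-trans (ℕP.m≤m+n _ _) p))) ⟩
      act A (act B s) j ∎
    where
    open ≡-Reasoning
    L = length A ℕ.+ length B
    g : ℤ → ℕ → ℕ → Carrier
    g j i m = cf A i * cf B m * s (j ℤ.- ⁺ (i ℕ.+ m))
    sub-+ : ∀ j i m → j ℤ.- ⁺ (i ℕ.+ m) ≡ (j ℤ.- ⁺ i) ℤ.- ⁺ m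
    sub-+ j i m = trans (cong (λ z → j ℤ.- z) (ℤP.pos-+ i m)) (lem j (⁺ i) (⁺ m))
      where
      lem : ∀ j a b → j ℤ.- (a ℤ.+ b) ≡ (j ℤ.- a) ℤ.- b
      lem = ℤ-solve
    row : ∀ j i → ∑ (L ∸ i) (g j i) ≡ cf A i * act B s (j ℤ.- ⁺ i)
    row j i with length A ℕP.≤? i
    ... | yes r = trans (∑-zero (L ∸ i) (λ m _ → trans (cong (λ z → z * cf B m * _) (coeff-beyond A i r))
                        (trans (cong (_* _) (zeroˡ _)) (zeroˡ _))))
                   (sym (trans (cong (_* _) (coeff-beyond A i r)) (zeroˡ _)))
    ... | no r = begin
        ∑ (L ∸ i) (g j i)
      ≡⟨ ∑-limits (length B) (L ∸ i) (λ m p → g-zero m p) (λ m p → g-zero m (ℕP.≤-trans lenB≤ p)) ⟩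
        ∑ (length B) (g j i)
      ≡⟨ ∑-cong (length B) (λ m _ → trans (*-assoc _ _ _) (cong (λ z → cf A i * (cf B m * s z)) (sub-+ j i m))) ⟩
        ∑ (length B) (λ m → cf A i * (cf B m * s ((j ℤ.- ⁺ i) ℤ.- ⁺ m)))
      ≡⟨ sym (∑-*ˡ (length B) _ _) ⟩
        cf A i * act B s (j ℤ.- ⁺ i) ∎
      where
      g-zero : ∀ m → length B ≤ m → g j i m ≡ 0#
      g-zero m p = trans (cong (λ z → cf A i * z * _) (coeff-beyond B m p)) (trans (cong (_* _) (zeroʳ _)) (zeroˡ _))
      lenB≤ : length B ≤ L ∸ i
      lenB≤ = ℕP.≤-trans (ℕP.≤-reflexive (sym (ℕP.m+n∸m≡n i (length B))))
                (ℕP.∸-monoˡ-≤ i (ℕP.+-monoˡ-≤ (length B) (ℕP.<⇒≤ (ℕP.≰⇒> r))))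

  act-comm : ∀ A B s → act A (act B s) ≐ act B (act A s)
  act-comm A B s = ≐-trans (≐-sym (act-mulP A B s))
    (≐-trans (act-congˡ (mulP F A B) (mulP F B A) s (mulP-comm A B)) (act-mulP B A s))

  act-embed : ∀ A B → act A (embed F B) ≐ embed F (mulP F A B)
  act-embed A B = mk≐ λ
    { -[1+ m ] → ∑-zero (length A) λ n _ → trans (cong (_ *_) (neg-sub m n)) (zeroʳ _)
    ; (⁺ m) → begin
        act A (embed F B) (⁺ m)
      ≡⟨ ∑-limits (suc m) (length A) (λ n p → trans (cong (_ *_) (emb-< m n p)) (zeroʳ _))
                                      (λ n p → trans (cong (_* _) (coeff-beyond A n p)) (zeroˡ _)) ⟩
        ∑ (suc m) (λ n → cf A n * embed F B (⁺ m ℤ.- ⁺ n))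
      ≡⟨ ∑-cong (suc m) (λ n p → cong (_ *_) (emb-≤ m n (ℕP.≤-pred p))) ⟩
        conv A B m
      ≡⟨ sym (coeff-mulP A B m) ⟩
        embed F (mulP F A B) (⁺ m) ∎ }
    where
    open ≡-Reasoning
    emb-≤ : ∀ m n → n ≤ m → embed F B (⁺ m ℤ.- ⁺ n) ≡ cf B (m ∸ n)
    emb-≤ m n p = trans (app (embed≐extend B) (⁺ m ℤ.- ⁺ n)) (extend-≤ (cf B) m n p)
    emb-< : ∀ m n → m < n → embed F B (⁺ m ℤ.- ⁺ n) ≡ 0#
    emb-< m n p = trans (app (embed≐extend B) (⁺ m ℤ.- ⁺ n)) (extend-< (cf B) m n p)
    neg-sub : ∀ m n → embed F B (-[1+ m ] ℤ.- ⁺ n) ≡ 0#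
    neg-sub m zero = refl
    neg-sub m (suc n) = refl

  act-swap-embed : ∀ X C V → act X (act C (embed F V)) ≐ act C (embed F (mulP F X V))
  act-swap-embed X C V = ≐-trans (act-comm X C (embed F V)) (act-congʳ C (act-embed X V))

  -- Integer inequalities as explicit differences (the arithmetic is then ring normalisation).

  ≤-witness : ∀ {a b} → a ℤ.≤ b → Σ[ k ∈ ℕ ] b ≡ a ℤ.+ ⁺ k
  ≤-witness {a} {b} p = ℤ.∣ b ℤ.- a ∣ , trans (lem a b) (cong (λ z → a ℤ.+ z) (sym (ℤP.0≤i⇒+∣i∣≡i (ℤP.i≤j⇒0≤j-i p))))
    where
    lem : ∀ a b → b ≡ a ℤ.+ (b ℤ.- a)
    lem = ℤ-solve

  ≤-from-witness : ∀ {a b} k → b ≡ a ℤ.+ ⁺ k → a ℤ.≤ b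
  ≤-from-witness {a} k e = subst (a ℤ.≤_) (sym e) (ℤP.i≤i+j a (⁺ k))

  <-witness : ∀ {a b} → a ℤ.< b → Σ[ k ∈ ℕ ] b ≡ (a ℤ.+ ⁺ k) ℤ.+ ⁺ 1
  <-witness {a} p with ≤-witness (ℤP.i<j⇒suc[i]≤j p)
  ... | k , e = k , trans e (lem a (⁺ k))
    where
    lem : ∀ a k → (⁺ 1 ℤ.+ a) ℤ.+ k ≡ (a ℤ.+ k) ℤ.+ ⁺ 1
    lem = ℤ-solve

  <-from-witness : ∀ {a b} k → b ≡ (a ℤ.+ ⁺ k) ℤ.+ ⁺ 1 → a ℤ.< b
  <-from-witness {a} k e = ℤP.suc[i]≤j⇒i<j (≤-from-witness k (trans e (lem a (⁺ k))))
    where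
    lem : ∀ a k → (a ℤ.+ k) ℤ.+ ⁺ 1 ≡ (⁺ 1 ℤ.+ a) ℤ.+ k
    lem = ℤ-solve

  sub-negative : ∀ {a b} → a ℤ.< b → a ℤ.- b ℤ.< ⁺ 0
  sub-negative {a} p with <-witness p
  ... | k , b≡ = <-from-witness k (trans (lem a (⁺ k)) (cong (λ z → ((a ℤ.- z) ℤ.+ ⁺ k) ℤ.+ ⁺ 1) (sym b≡)))
    where
    lem : ∀ a k → ⁺ 0 ≡ ((a ℤ.- ((a ℤ.+ k) ℤ.+ ⁺ 1)) ℤ.+ k) ℤ.+ ⁺ 1
    lem = ℤ-solve

  ≤-∣∣ : ∀ b → b ℤ.≤ ⁺ ℤ.∣ b ∣
  ≤-∣∣ (⁺ n) = ℤP.≤-refl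
  ≤-∣∣ -[1+ n ] = ℤ.-≤+

  -∣∣-≤ : ∀ j → ℤ.- ⁺ ℤ.∣ j ∣ ℤ.≤ j
  -∣∣-≤ (⁺ zero) = ℤP.≤-refl
  -∣∣-≤ (⁺ suc n) = ℤ.-≤+
  -∣∣-≤ -[1+ n ] = ℤP.≤-refl

  VanishAbove : Seq → ℤ → Set
  VanishAbove s t = ∀ j → t ℤ.< j → s j ≡ 0#

  Bounded : Seq → Set
  Bounded s = Σ[ t ∈ ℤ ] VanishAbove s t

  vanish-mono : ∀ {s t u} → t ℤ.≤ u → VanishAbove s t → VanishAbove s u
  vanish-mono t≤u b j q = b j (ℤP.≤-<-trans t≤u q)

  vanish-cong : ∀ {s t u} → s ≐ t → VanishAbove s u → VanishAbove t u
  vanish-cong e b j p = trans (sym (app e j)) (b j p)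

  vanish-everywhere : ∀ s → (∀ t → VanishAbove s t) → s ≐ 0S
  vanish-everywhere s h = mk≐ λ j → h (j ℤ.- ⁺ 1) j (<-from-witness 0 (lem j))
    where
    lem : ∀ j → j ≡ ((j ℤ.- ⁺ 1) ℤ.+ ⁺ 0) ℤ.+ ⁺ 1
    lem = ℤ-solve

  vanish-lc : ∀ (β : Laurent F) → VanishAbove (lc β) (top β)
  vanish-lc β = vanish β

  bounded-lc : ∀ (β : Laurent F) → Bounded (lc β)
  bounded-lc β = top β , vanish β

  bounded-+S : ∀ {s t} → Bounded s → Bounded t → Bounded (s +S t)
  bounded-+S (a , ba) (b , bb) = a ℤ.⊔ b , λ j p →
    trans (cong₂ _+_ (ba j (ℤP.≤-<-trans (ℤP.i≤i⊔j a b) p)) (bb j (ℤP.≤-<-trans (ℤP.i≤j⊔i a b) p))) (+-identityʳ 0#)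

  bounded--S : ∀ {s t} → Bounded s → Bounded t → Bounded (s -S t)
  bounded--S (a , ba) (b , bb) = a ℤ.⊔ b , λ j p →
    trans (cong₂ (λ x y → x + - y) (ba j (ℤP.≤-<-trans (ℤP.i≤i⊔j a b) p)) (bb j (ℤP.≤-<-trans (ℤP.i≤j⊔i a b) p))) 0-0≡0

  vanish-embed : ∀ V d → DegLe V d → VanishAbove (embed F V) (⁺ d)
  vanish-embed V d h (⁺ n) (ℤ.+<+ p) = h n p
  vanish-embed V d h -[1+ n ] p = refl

  degLe-from-vanish : ∀ V d → VanishAbove (embed F V) (⁺ d) → DegLe V d
  degLe-from-vanish V d h n p = h (⁺ n) (ℤ.+<+ p)

  bounded-embed : ∀ V → Bounded (embed F V)
  bounded-embed V = ⁺ length V , vanish-embed V (length V) (degLe-length V)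

  act-vanish : ∀ A d s t → DegLe A d → VanishAbove s t → VanishAbove (act A s) (t ℤ.+ ⁺ d)
  act-vanish A d s t dA bs j p = ∑-zero (length A) term-zero
    where
    term-zero : ∀ n → n < length A → cf A n * s (j ℤ.- ⁺ n) ≡ 0#
    term-zero n _ with d ℕP.<? n
    ... | yes q = trans (cong (_* _) (dA n q)) (zeroˡ _)
    ... | no q = trans (cong (_ *_) (bs _ (<-from-witness (d ∸ n ℕ.+ k) j-n≡))) (zeroʳ _)
      where
      k = proj₁ (<-witness p)
      lem : ∀ t n m k → ((t ℤ.+ (n ℤ.+ m)) ℤ.+ k) ℤ.+ ⁺ 1 ℤ.- n ≡ (t ℤ.+ (m ℤ.+ k)) ℤ.+ ⁺ 1
      lem = ℤ-solve
      j-n≡ : j ℤ.- ⁺ n ≡ (t ℤ.+ ⁺ (d ∸ n ℕ.+ k)) ℤ.+ ⁺ 1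
      j-n≡ = begin
          j ℤ.- ⁺ n
        ≡⟨ cong (ℤ._- ⁺ n) (proj₂ (<-witness p)) ⟩
          ((t ℤ.+ ⁺ d) ℤ.+ ⁺ k) ℤ.+ ⁺ 1 ℤ.- ⁺ n
        ≡⟨ cong (λ z → ((t ℤ.+ z) ℤ.+ ⁺ k) ℤ.+ ⁺ 1 ℤ.- ⁺ n)
                (trans (cong ⁺_ (sym (ℕP.m+[n∸m]≡n (ℕP.≮⇒≥ q)))) (ℤP.pos-+ n (d ∸ n))) ⟩
          ((t ℤ.+ (⁺ n ℤ.+ ⁺ (d ∸ n))) ℤ.+ ⁺ k) ℤ.+ ⁺ 1 ℤ.- ⁺ n
        ≡⟨ lem t (⁺ n) (⁺ (d ∸ n)) (⁺ k) ⟩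
          (t ℤ.+ (⁺ (d ∸ n) ℤ.+ ⁺ k)) ℤ.+ ⁺ 1
        ≡⟨ cong (λ z → (t ℤ.+ z) ℤ.+ ⁺ 1) (sym (ℤP.pos-+ (d ∸ n) k)) ⟩
          (t ℤ.+ ⁺ (d ∸ n ℕ.+ k)) ℤ.+ ⁺ 1 ∎
        where open ≡-Reasoning

  bounded-act : ∀ A {s} → Bounded s → Bounded (act A s)
  bounded-act A (t , b) = t ℤ.+ ⁺ length A , act-vanish A (length A) _ t (degLe-length A) b

  act-top : ∀ A d s t → DegLe A d → VanishAbove s t → act A s (t ℤ.+ ⁺ d) ≡ cf A d * s t
  act-top A d s t dA bs = begin
      act A s (t ℤ.+ ⁺ d)
    ≡⟨ act-upto A (suc d) s (t ℤ.+ ⁺ d) dA ⟩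
      ∑ d (λ n → cf A n * s ((t ℤ.+ ⁺ d) ℤ.- ⁺ n)) + cf A d * s ((t ℤ.+ ⁺ d) ℤ.- ⁺ d)
    ≡⟨ cong₂ _+_ (∑-zero d term-zero) (cong (λ z → cf A d * s z) (lem t (⁺ d))) ⟩
      0# + cf A d * s t
    ≡⟨ +-identityˡ _ ⟩
      cf A d * s t ∎
    where
    open ≡-Reasoning
    lem : ∀ t d → (t ℤ.+ d) ℤ.- d ≡ t
    lem = ℤ-solve
    lem₂ : ∀ t n m → (t ℤ.+ (n ℤ.+ (⁺ 1 ℤ.+ m))) ℤ.- n ≡ (t ℤ.+ m) ℤ.+ ⁺ 1
    lem₂ = ℤ-solve
    term-zero : ∀ n → n < d → cf A n * s ((t ℤ.+ ⁺ d) ℤ.- ⁺ n) ≡ 0#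
    term-zero n p = trans (cong (_ *_) (bs _ (<-from-witness (d ∸ suc n) index≡))) (zeroʳ _)
      where
      d≡ : ⁺ d ≡ ⁺ n ℤ.+ (⁺ 1 ℤ.+ ⁺ (d ∸ suc n))
      d≡ = trans (cong ⁺_ (trans (sym (ℕP.m+[n∸m]≡n (ℕP.<⇒≤ p))) (cong (n ℕ.+_) (ℕP.+-∸-assoc 1 p))))
                 (trans (ℤP.pos-+ n _) (cong (λ z → ⁺ n ℤ.+ z) (ℤP.pos-+ 1 _)))
      index≡ : (t ℤ.+ ⁺ d) ℤ.- ⁺ n ≡ (t ℤ.+ ⁺ (d ∸ suc n)) ℤ.+ ⁺ 1
      index≡ = trans (cong (λ z → (t ℤ.+ z) ℤ.- ⁺ n) d≡) (lem₂ t (⁺ n) (⁺ (d ∸ suc n)))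

  vanish-from-act : ∀ A d s t u → HasDegree F A d → Bounded s → VanishAbove (act A s) u → u ≡ t ℤ.+ ⁺ d →
    VanishAbove s t
  vanish-from-act A d s t u (lead≢0 , dA) (t₀ , b₀) hu refl with t₀ ℤP.≤? t
  ... | yes t₀≤t = vanish-mono t₀≤t b₀
  ... | no t₀≰t = lower (proj₁ gap) t₀ b₀ (ℤP.≤-reflexive (proj₂ gap))
    where
    gap = ≤-witness (ℤP.<⇒≤ (ℤP.≰⇒> t₀≰t))
    -- lower the bound u one step at a time, using that the top coefficient of A · s vanishes
    lower : ∀ r u → VanishAbove s u → u ℤ.≤ t ℤ.+ ⁺ r → VanishAbove s t
    lower zero u b p = vanish-mono (subst (u ℤ.≤_) (ℤP.+-identityʳ t) p) b
    lower (suc r) u b p with u ℤP.≤? t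
    ... | yes u≤t = vanish-mono u≤t b
    ... | no u≰t = lower r (u ℤ.- ⁺ 1) b′ p′
      where
      top-zero : s u ≡ 0#
      top-zero = nonzero-*-cancel _ _ lead≢0
        (trans (sym (act-top A d s u dA b)) (hu _ (ℤP.+-monoˡ-< (⁺ d) (ℤP.≰⇒> u≰t))))
      lem : ∀ u → ⁺ 1 ℤ.+ (u ℤ.- ⁺ 1) ≡ u
      lem = ℤ-solve
      b′ : VanishAbove s (u ℤ.- ⁺ 1)
      b′ j pj with j ℤ.≟ u
      ... | yes refl = top-zero
      ... | no j≢u = b j (ℤP.≤∧≢⇒< (subst (ℤ._≤ j) (lem u) (ℤP.i<j⇒suc[i]≤j pj)) (λ e → j≢u (sym e)))
      lem₂ : ∀ t r → (t ℤ.+ (⁺ 1 ℤ.+ r)) ℤ.- ⁺ 1 ≡ t ℤ.+ r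
      lem₂ = ℤ-solve
      p′ : u ℤ.- ⁺ 1 ℤ.≤ t ℤ.+ ⁺ r
      p′ = subst (u ℤ.- ⁺ 1 ℤ.≤_) (lem₂ t (⁺ r)) (ℤP.+-monoˡ-≤ (ℤ.- ⁺ 1) p)

  act-injective : ∀ A d {u w} → HasDegree F A d → Bounded u → Bounded w → act A u ≐ act A w → u ≐ w
  act-injective A d {u} {w} hA bu bw e =
    mk≐ λ j → sub≡0⇒≡ _ _ (app (vanish-everywhere (u -S w) λ t →
      vanish-from-act A d (u -S w) t _ hA (bounded--S bu bw) (act-diff-zero t) refl) j)
    where
    act-diff-zero : ∀ t → VanishAbove (act A (u -S w)) (t ℤ.+ ⁺ d)
    act-diff-zero t i p = trans (app (act--S A u w) i) (trans (cong (_+ - act A w i) (app e i)) (-‿inverseʳ _))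

  -- Long division: a sequence vanishing above T is A · y for some y vanishing above T - deg A.
  -- The coefficients c r = y (T - d - r) are determined from the top down by
  --   c r = a⁻¹ (x (T - r) - ∑_{n < d} A_n c (r - d + n)),   a the leading coefficient.

  module LongDivision (A : Pol) (d : ℕ) (x : Seq) (T : ℤ) (hA : HasDegree F A d) (bx : VanishAbove x T) where
    a⁻¹ = inv (cf A d) (proj₁ hA)

    next : (ℕ → Carrier) → ℕ → Carrier
    next f r = a⁻¹ * (x (T ℤ.- ⁺ r) + - ∑ d (λ n → cf A n * extend f (⁺ r ℤ.- ⁺ (d ∸ n))))

    -- course-of-values recursion: table r holds the correct values at all indices ≤ r
    table : ℕ → ℕ → Carrier
    table zero i = next (λ _ → 0#) 0
    table (suc r) i with i ℕP.≤? r
    ... | yes _ = table r i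
    ... | no _ = next (table r) (suc r)

    c : ℕ → Carrier
    c r = table r r

    table-stable : ∀ k r i → i ≤ r → table (k ℕ.+ r) i ≡ table r i
    table-stable zero r i p = refl
    table-stable (suc k) r i p with i ℕP.≤? (k ℕ.+ r)
    ... | yes _ = table-stable k r i p
    ... | no q = ⊥-elim (q (ℕP.≤-trans p (ℕP.m≤n+m r k)))

    next-cong : ∀ f g r → (∀ i → i < r → f i ≡ g i) → next f r ≡ next g r
    next-cong f g r h = cong (λ z → a⁻¹ * (x (T ℤ.- ⁺ r) + - z)) (∑-cong d λ n p → cong (_ *_) (same n p))
      where
      same : ∀ n → n < d → extend f (⁺ r ℤ.- ⁺ (d ∸ n)) ≡ extend g (⁺ r ℤ.- ⁺ (d ∸ n))
      same n p with (d ∸ n) ℕP.≤? r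
      ... | yes q = trans (extend-≤ f r _ q) (trans (h _ (ℕP.∸-monoʳ-< {r} {d ∸ n} {0} (ℕP.m<n⇒0<n∸m p) q))
                                                    (sym (extend-≤ g r _ q)))
      ... | no q = trans (extend-< f r _ (ℕP.≰⇒> q)) (sym (extend-< g r _ (ℕP.≰⇒> q)))

    c-recursion : ∀ r → c r ≡ next c r
    c-recursion zero = next-cong _ _ zero (λ i ())
    c-recursion (suc r) with suc r ℕP.≤? r
    ... | yes q = ⊥-elim (ℕP.<-irrefl refl q)
    ... | no _ = next-cong _ _ (suc r) λ i p →
      trans (cong (λ z → table z i) (sym (ℕP.m∸n+n≡m (ℕP.≤-pred p)))) (table-stable (r ∸ i) i i ℕP.≤-refl)

    quotient : Seq
    quotient j = extend c ((T ℤ.- ⁺ d) ℤ.- j)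

    quotient-vanish : VanishAbove quotient (T ℤ.- ⁺ d)
    quotient-vanish j p = extend-neg c _ (sub-negative p)

    index≡ : ∀ j r n → T ≡ j ℤ.+ ⁺ r → n ≤ d → (T ℤ.- ⁺ d) ℤ.- (j ℤ.- ⁺ n) ≡ ⁺ r ℤ.- ⁺ (d ∸ n)
    index≡ j r n T≡ p = trans (cong₂ (λ u v → (u ℤ.- v) ℤ.- (j ℤ.- ⁺ n)) T≡ d≡) (lem j (⁺ r) (⁺ n) (⁺ (d ∸ n)))
      where
      d≡ : ⁺ d ≡ ⁺ n ℤ.+ ⁺ (d ∸ n)
      d≡ = trans (cong ⁺_ (sym (ℕP.m+[n∸m]≡n p))) (ℤP.pos-+ n (d ∸ n))
      lem : ∀ j r n m → ((j ℤ.+ r) ℤ.- (n ℤ.+ m)) ℤ.- (j ℤ.- n) ≡ r ℤ.- m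
      lem = ℤ-solve

    quotient-correct : act A quotient ≐ x
    quotient-correct = mk≐ correct-at
      where
      correct-at : ∀ j → act A quotient j ≡ x j
      correct-at j with T ℤP.<? j
      ... | yes p = trans (act-vanish A d quotient (T ℤ.- ⁺ d) (proj₂ hA) quotient-vanish j
                             (subst (ℤ._< j) (sym (lem T (⁺ d))) p))
                          (sym (bx j p))
        where
        lem : ∀ T d → (T ℤ.- d) ℤ.+ d ≡ T
        lem = ℤ-solve
      ... | no p with ≤-witness (ℤP.≮⇒≥ p)
      ... | r , T≡ = begin
          act A quotient j
        ≡⟨ act-upto A (suc d) quotient j (proj₂ hA) ⟩
          ∑ d (λ n → cf A n * quotient (j ℤ.- ⁺ n)) + cf A d * quotient (j ℤ.- ⁺ d)
        ≡⟨ cong₂ _+_ (∑-cong d (λ n q → cong (λ z → cf A n * extend c z) (index≡ j r n T≡ (ℕP.<⇒≤ q))))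
                     (cong (λ z → cf A d * extend c z)
                           (trans (index≡ j r d T≡ ℕP.≤-refl) (cong (λ z → ⁺ r ℤ.- ⁺ z) (ℕP.n∸n≡0 d)))) ⟩
          S + cf A d * extend c (⁺ r ℤ.- ⁺ 0)
        ≡⟨ cong (λ z → S + cf A d * z) (trans (extend-≤ c r 0 z≤n) (c-recursion r)) ⟩
          S + cf A d * (a⁻¹ * (x (T ℤ.- ⁺ r) + - S))
        ≡⟨ cong (S +_) (trans (sym (*-assoc _ _ _))
                 (trans (cong (_* (x (T ℤ.- ⁺ r) + - S)) (inv-correct (cf A d) (proj₁ hA))) (*-identityˡ _))) ⟩
          S + (x (T ℤ.- ⁺ r) + - S)
        ≡⟨ add-sub-cancel S _ ⟩
          x (T ℤ.- ⁺ r)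
        ≡⟨ cong x (trans (cong (ℤ._- ⁺ r) T≡) (lem j (⁺ r))) ⟩
          x j ∎
        where
        open ≡-Reasoning
        S = ∑ d (λ n → cf A n * extend c (⁺ r ℤ.- ⁺ (d ∸ n)))
        lem : ∀ j r → (j ℤ.+ r) ℤ.- r ≡ j
        lem = ℤ-solve

  divide : ∀ A d x T → HasDegree F A d → VanishAbove x T →
    Σ[ y ∈ Seq ] (VanishAbove y (T ℤ.- ⁺ d) × act A y ≐ x)
  divide A d x T hA bx = quotient , quotient-vanish , quotient-correct
    where open LongDivision A d x T hA bx

  module Expansions (P Q : Pol) (dP′ dQ : ℕ)
                    (hP : HasDegree F P (suc dP′)) (hQ : HasDegree F Q dQ) (dQ≤dP′ : dQ ≤ dP′) where
    dP = suc dP′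
    e′ = dP′ ∸ dQ

    -- e = deg P - deg Q ≥ 1
    e : ℤ
    e = ⁺ (suc e′)

    dP′≡ : ⁺ dP′ ≡ ⁺ dQ ℤ.+ ⁺ e′
    dP′≡ = trans (cong ⁺_ (sym (ℕP.m+[n∸m]≡n dQ≤dP′))) (ℤP.pos-+ dQ e′)

    dP≡ : ⁺ dP ≡ ⁺ 1 ℤ.+ (⁺ dQ ℤ.+ ⁺ e′)
    dP≡ = cong (λ z → ⁺ 1 ℤ.+ z) dP′≡

    -- (P/Q)^t = num t / den t
    num den : ℤ → Pol
    num (⁺ m) = powP F P m
    num -[1+ m ] = powP F Q (suc m)
    den (⁺ m) = powP F Q m
    den -[1+ m ] = powP F P (suc m)

    deg-num deg-den : ℤ → ℕ
    deg-num (⁺ m) = m ℕ.* dP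
    deg-num -[1+ m ] = suc m ℕ.* dQ
    deg-den (⁺ m) = m ℕ.* dQ
    deg-den -[1+ m ] = suc m ℕ.* dP

    num-degree : ∀ t → HasDegree F (num t) (deg-num t)
    num-degree (⁺ m) = powP-deg P dP hP m
    num-degree -[1+ m ] = powP-deg Q dQ hQ (suc m)

    den-degree : ∀ t → HasDegree F (den t) (deg-den t)
    den-degree (⁺ m) = powP-deg Q dQ hQ m
    den-degree -[1+ m ] = powP-deg P dP hP (suc m)

    deg-num≡ : ∀ t → ⁺ deg-num t ≡ ⁺ deg-den t ℤ.+ t ℤ.* e
    deg-num≡ (⁺ m) = begin
        ⁺ (m ℕ.* dP)
      ≡⟨ trans (ℤP.pos-* m dP) (cong (⁺ m ℤ.*_) dP≡) ⟩
        ⁺ m ℤ.* (⁺ 1 ℤ.+ (⁺ dQ ℤ.+ ⁺ e′))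
      ≡⟨ lem (⁺ m) (⁺ dQ) (⁺ e′) ⟩
        ⁺ m ℤ.* ⁺ dQ ℤ.+ ⁺ m ℤ.* (⁺ 1 ℤ.+ ⁺ e′)
      ≡⟨ cong (ℤ._+ ⁺ m ℤ.* e) (sym (ℤP.pos-* m dQ)) ⟩
        ⁺ (m ℕ.* dQ) ℤ.+ ⁺ m ℤ.* e ∎
      where
      open ≡-Reasoning
      lem : ∀ m q s → m ℤ.* (⁺ 1 ℤ.+ (q ℤ.+ s)) ≡ m ℤ.* q ℤ.+ m ℤ.* (⁺ 1 ℤ.+ s)
      lem = ℤ-solve
    deg-num≡ -[1+ m ] = begin
        ⁺ (suc m ℕ.* dQ)
      ≡⟨ ℤP.pos-* (suc m) dQ ⟩
        (⁺ 1 ℤ.+ ⁺ m) ℤ.* ⁺ dQ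
      ≡⟨ lem (⁺ m) (⁺ dQ) (⁺ e′) ⟩
        (⁺ 1 ℤ.+ ⁺ m) ℤ.* (⁺ 1 ℤ.+ (⁺ dQ ℤ.+ ⁺ e′)) ℤ.+ (ℤ.- (⁺ 1 ℤ.+ ⁺ m)) ℤ.* (⁺ 1 ℤ.+ ⁺ e′)
      ≡⟨ cong (λ z → (⁺ 1 ℤ.+ ⁺ m) ℤ.* z ℤ.+ -[1+ m ] ℤ.* e) (sym dP≡) ⟩
        (⁺ 1 ℤ.+ ⁺ m) ℤ.* ⁺ dP ℤ.+ -[1+ m ] ℤ.* e
      ≡⟨ cong (ℤ._+ -[1+ m ] ℤ.* e) (sym (ℤP.pos-* (suc m) dP)) ⟩
        ⁺ (suc m ℕ.* dP) ℤ.+ -[1+ m ] ℤ.* e ∎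
      where
      open ≡-Reasoning
      lem : ∀ m q s → (⁺ 1 ℤ.+ m) ℤ.* q ≡ (⁺ 1 ℤ.+ m) ℤ.* (⁺ 1 ℤ.+ (q ℤ.+ s)) ℤ.+ (ℤ.- (⁺ 1 ℤ.+ m)) ℤ.* (⁺ 1 ℤ.+ s)
      lem = ℤ-solve

    -- the term s (P/Q)^i is the solution β of  term-den i · β = s · scale i
    term-den scale : ℤ → Pol
    term-den (⁺ m) = powP F Q (suc m)
    term-den -[1+ m ] = powP F P (suc m)
    scale (⁺ m) = powP F P m
    scale -[1+ m ] = powP F Q m

    deg-term-den deg-scale : ℤ → ℕ
    deg-term-den (⁺ m) = suc m ℕ.* dQ
    deg-term-den -[1+ m ] = suc m ℕ.* dP
    deg-scale (⁺ m) = m ℕ.* dP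
    deg-scale -[1+ m ] = m ℕ.* dQ

    term-den-degree : ∀ i → HasDegree F (term-den i) (deg-term-den i)
    term-den-degree (⁺ m) = powP-deg Q dQ hQ (suc m)
    term-den-degree -[1+ m ] = powP-deg P dP hP (suc m)

    scale-degree : ∀ i → HasDegree F (scale i) (deg-scale i)
    scale-degree (⁺ m) = powP-deg P dP hP m
    scale-degree -[1+ m ] = powP-deg Q dQ hQ m

    IsTerm⇒ : ∀ i s β → IsTerm F P Q s i β → act (term-den i) (lc β) ≐ embed F (mulP F s (scale i))
    IsTerm⇒ (⁺ m) s β h = mk≐ h
    IsTerm⇒ -[1+ m ] s β h = mk≐ h

    IsTerm⇐ : ∀ i s β → act (term-den i) (lc β) ≐ embed F (mulP F s (scale i)) → IsTerm F P Q s i β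
    IsTerm⇐ (⁺ m) s β h = app h
    IsTerm⇐ -[1+ m ] s β h = app h

    -- A relation  den t · S = num t · V  (S = V (P/Q)^t) at level i or i + 1, rescaled to
    -- the denominator of the i-th term, with Q V resp. P V in place of V.
    lift₀ : ∀ i {V S} → act (den i) S ≐ act (num i) (embed F V) →
      act (term-den i) S ≐ act (scale i) (embed F (mulP F Q V))
    lift₀ (⁺ m) {V} {S} h = begin
        act (mulP F Q (powP F Q m)) S
      ≐⟨ act-mulP Q (powP F Q m) S ⟩
        act Q (act (powP F Q m) S)
      ≐⟨ act-congʳ Q h ⟩
        act Q (act (powP F P m) (embed F V))
      ≐⟨ act-swap-embed Q (powP F P m) V ⟩
        act (powP F P m) (embed F (mulP F Q V)) ∎
      where open ≐-Reasoning
    lift₀ -[1+ m ] {V} {S} h = begin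
        act (powP F P (suc m)) S
      ≐⟨ h ⟩
        act (mulP F Q (powP F Q m)) (embed F V)
      ≐⟨ act-mulP Q (powP F Q m) (embed F V) ⟩
        act Q (act (powP F Q m) (embed F V))
      ≐⟨ act-swap-embed Q (powP F Q m) V ⟩
        act (powP F Q m) (embed F (mulP F Q V)) ∎
      where open ≐-Reasoning

    unlift₀ : ∀ i {V S} → Bounded S → act (term-den i) S ≐ act (scale i) (embed F (mulP F Q V)) →
      act (den i) S ≐ act (num i) (embed F V)
    unlift₀ (⁺ m) {V} {S} bS h =
      act-injective Q dQ {act (powP F Q m) S} {act (powP F P m) (embed F V)} hQ
        (bounded-act (powP F Q m) bS) (bounded-act (powP F P m) (bounded-embed V)) (begin
        act Q (act (powP F Q m) S)
      ≐⟨ ≐-sym (act-mulP Q (powP F Q m) S) ⟩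
        act (mulP F Q (powP F Q m)) S
      ≐⟨ h ⟩
        act (powP F P m) (embed F (mulP F Q V))
      ≐⟨ ≐-sym (act-swap-embed Q (powP F P m) V) ⟩
        act Q (act (powP F P m) (embed F V)) ∎)
      where open ≐-Reasoning
    unlift₀ -[1+ m ] {V} {S} _ h = begin
        act (powP F P (suc m)) S
      ≐⟨ h ⟩
        act (powP F Q m) (embed F (mulP F Q V))
      ≐⟨ ≐-sym (act-swap-embed Q (powP F Q m) V) ⟩
        act Q (act (powP F Q m) (embed F V))
      ≐⟨ ≐-sym (act-mulP Q (powP F Q m) (embed F V)) ⟩
        act (mulP F Q (powP F Q m)) (embed F V) ∎
      where open ≐-Reasoning

    lift₁ : ∀ i {V S} → act (den (ℤ.suc i)) S ≐ act (num (ℤ.suc i)) (embed F V) →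
      act (term-den i) S ≐ act (scale i) (embed F (mulP F P V))
    lift₁ (⁺ m) {V} {S} h = begin
        act (powP F Q (suc m)) S
      ≐⟨ h ⟩
        act (mulP F P (powP F P m)) (embed F V)
      ≐⟨ act-mulP P (powP F P m) (embed F V) ⟩
        act P (act (powP F P m) (embed F V))
      ≐⟨ act-swap-embed P (powP F P m) V ⟩
        act (powP F P m) (embed F (mulP F P V)) ∎
      where open ≐-Reasoning
    lift₁ -[1+ zero ] {V} {S} h = begin
        act (mulP F P (powP F P 0)) S
      ≐⟨ act-mulP P (powP F P 0) S ⟩
        act P (act (powP F P 0) S)
      ≐⟨ act-congʳ P h ⟩
        act P (act (powP F Q 0) (embed F V))
      ≐⟨ act-swap-embed P (powP F Q 0) V ⟩
        act (powP F Q 0) (embed F (mulP F P V)) ∎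
      where open ≐-Reasoning
    lift₁ -[1+ suc m ] {V} {S} h = begin
        act (mulP F P (powP F P (suc m))) S
      ≐⟨ act-mulP P (powP F P (suc m)) S ⟩
        act P (act (powP F P (suc m)) S)
      ≐⟨ act-congʳ P h ⟩
        act P (act (powP F Q (suc m)) (embed F V))
      ≐⟨ act-swap-embed P (powP F Q (suc m)) V ⟩
        act (powP F Q (suc m)) (embed F (mulP F P V)) ∎
      where open ≐-Reasoning

    scaled-edge : ∀ C V₁ V₀ s → _≈P_ F (mulP F Q V₀) (addP F (mulP F P V₁) s) →
      act C (embed F (mulP F Q V₀)) ≐ act C (embed F (mulP F P V₁)) +S embed F (mulP F s C)
    scaled-edge C V₁ V₀ s edge = begin
        act C (embed F (mulP F Q V₀))
      ≐⟨ act-congʳ C (≐-trans (embed-cong _ _ edge) (embed-addP _ _)) ⟩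
        act C (embed F (mulP F P V₁) +S embed F s)
      ≐⟨ act-+S C (embed F (mulP F P V₁)) (embed F s) ⟩
        act C (embed F (mulP F P V₁)) +S act C (embed F s)
      ≐⟨ +S-cong ≐-refl (≐-trans (act-embed C s) (embed-mulP-comm C s)) ⟩
        act C (embed F (mulP F P V₁)) +S embed F (mulP F s C) ∎
      where open ≐-Reasoning

    difference-is-term : ∀ i {V₁ V₀ s S₁ S₀} →
      act (den (ℤ.suc i)) S₁ ≐ act (num (ℤ.suc i)) (embed F V₁) →
      act (den i) S₀ ≐ act (num i) (embed F V₀) →
      _≈P_ F (mulP F Q V₀) (addP F (mulP F P V₁) s) →
      act (term-den i) (S₀ -S S₁) ≐ embed F (mulP F s (scale i))
    difference-is-term i {V₁} {V₀} {s} {S₁} {S₀} h₁ h₀ edge = begin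
        act (term-den i) (S₀ -S S₁)
      ≐⟨ act--S (term-den i) S₀ S₁ ⟩
        act (term-den i) S₀ -S act (term-den i) S₁
      ≐⟨ -S-cong (lift₀ i {V₀} {S₀} h₀) (lift₁ i {V₁} {S₁} h₁) ⟩
        act (scale i) (embed F (mulP F Q V₀)) -S act (scale i) (embed F (mulP F P V₁))
      ≐⟨ mk≐ (λ j → sub-from-sum _ _ _ (app (scaled-edge (scale i) V₁ V₀ s edge) j)) ⟩
        embed F (mulP F s (scale i)) ∎
      where open ≐-Reasoning

    add-term : ∀ i {V₁ V₀ s S} (β : Laurent F) → Bounded S →
      act (den (ℤ.suc i)) S ≐ act (num (ℤ.suc i)) (embed F V₁) →
      act (term-den i) (lc β) ≐ embed F (mulP F s (scale i)) →
      _≈P_ F (mulP F Q V₀) (addP F (mulP F P V₁) s) →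
      act (den i) (S +S lc β) ≐ act (num i) (embed F V₀)
    add-term i {V₁} {V₀} {s} {S} β bS h₁ hβ edge = unlift₀ i {V₀} {S +S lc β} (bounded-+S bS (bounded-lc β)) (begin
        act (term-den i) (S +S lc β)
      ≐⟨ act-+S (term-den i) S (lc β) ⟩
        act (term-den i) S +S act (term-den i) (lc β)
      ≐⟨ +S-cong (lift₁ i {V₁} {S} h₁) hβ ⟩
        act (scale i) (embed F (mulP F P V₁)) +S embed F (mulP F s (scale i))
      ≐⟨ ≐-sym (scaled-edge (scale i) V₁ V₀ s edge) ⟩
        act (scale i) (embed F (mulP F Q V₀)) ∎)
      where open ≐-Reasoning

    -- Bounds.  A level-t approximation of α agrees with α above bound t = t e - 1.

    bound : ℤ → ℤ
    bound t = t ℤ.* e ℤ.- ⁺ 1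

    bound-mono : ∀ {a b} → a ℤ.≤ b → bound a ℤ.≤ bound b
    bound-mono p = ℤP.+-monoˡ-≤ (ℤ.- ⁺ 1) (ℤP.*-monoʳ-≤-nonNeg e p)

    bound-below : ∀ t M → t ℤ.≤ ℤ.- ⁺ M → bound t ℤ.< ℤ.- ⁺ M
    bound-below t M p = ℤP.≤-<-trans (bound-mono p) (<-from-witness (M ℕ.* e′)
      (trans (lem (⁺ M) (⁺ e′)) (cong (λ z → (bound (ℤ.- ⁺ M) ℤ.+ z) ℤ.+ ⁺ 1) (sym (ℤP.pos-* M e′)))))
      where
      lem : ∀ M f → ℤ.- M ≡ ((ℤ.- M ℤ.* (⁺ 1 ℤ.+ f) ℤ.- ⁺ 1) ℤ.+ M ℤ.* f) ℤ.+ ⁺ 1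
      lem = ℤ-solve

    -- deg (s · scale i) ≤ dP′ + deg (scale i) = bound (i + 1) + deg (term-den i)
    term-degrees : ∀ i → ⁺ (dP′ ℕ.+ deg-scale i) ≡ bound (ℤ.suc i) ℤ.+ ⁺ deg-term-den i
    term-degrees (⁺ m) = begin
        ⁺ (dP′ ℕ.+ m ℕ.* dP)
      ≡⟨ trans (ℤP.pos-+ dP′ (m ℕ.* dP)) (cong₂ ℤ._+_ dP′≡ (trans (ℤP.pos-* m dP) (cong (⁺ m ℤ.*_) dP≡))) ⟩
        (⁺ dQ ℤ.+ ⁺ e′) ℤ.+ ⁺ m ℤ.* (⁺ 1 ℤ.+ (⁺ dQ ℤ.+ ⁺ e′))
      ≡⟨ lem (⁺ m) (⁺ dQ) (⁺ e′) ⟩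
        ((⁺ 1 ℤ.+ ⁺ m) ℤ.* (⁺ 1 ℤ.+ ⁺ e′) ℤ.- ⁺ 1) ℤ.+ (⁺ 1 ℤ.+ ⁺ m) ℤ.* ⁺ dQ
      ≡⟨ cong (λ z → bound (ℤ.suc (⁺ m)) ℤ.+ z) (sym (ℤP.pos-* (suc m) dQ)) ⟩
        bound (ℤ.suc (⁺ m)) ℤ.+ ⁺ (suc m ℕ.* dQ) ∎
      where
      open ≡-Reasoning
      lem : ∀ m q s → (q ℤ.+ s) ℤ.+ m ℤ.* (⁺ 1 ℤ.+ (q ℤ.+ s)) ≡ ((⁺ 1 ℤ.+ m) ℤ.* (⁺ 1 ℤ.+ s) ℤ.- ⁺ 1) ℤ.+ (⁺ 1 ℤ.+ m) ℤ.* q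
      lem = ℤ-solve
    term-degrees -[1+ m ] = begin
        ⁺ (dP′ ℕ.+ m ℕ.* dQ)
      ≡⟨ trans (ℤP.pos-+ dP′ (m ℕ.* dQ)) (cong₂ ℤ._+_ dP′≡ (ℤP.pos-* m dQ)) ⟩
        (⁺ dQ ℤ.+ ⁺ e′) ℤ.+ ⁺ m ℤ.* ⁺ dQ
      ≡⟨ lem (⁺ m) (⁺ dQ) (⁺ e′) ⟩
        ((⁺ 1 ℤ.+ ℤ.- (⁺ 1 ℤ.+ ⁺ m)) ℤ.* (⁺ 1 ℤ.+ ⁺ e′) ℤ.- ⁺ 1) ℤ.+ (⁺ 1 ℤ.+ ⁺ m) ℤ.* (⁺ 1 ℤ.+ (⁺ dQ ℤ.+ ⁺ e′))
      ≡⟨ cong (λ z → bound (ℤ.suc -[1+ m ]) ℤ.+ z)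
              (trans (cong ((⁺ 1 ℤ.+ ⁺ m) ℤ.*_) (sym dP≡)) (sym (ℤP.pos-* (suc m) dP))) ⟩
        bound (ℤ.suc -[1+ m ]) ℤ.+ ⁺ (suc m ℕ.* dP) ∎
      where
      open ≡-Reasoning
      lem : ∀ m q s → (q ℤ.+ s) ℤ.+ m ℤ.* q ≡
        ((⁺ 1 ℤ.+ ℤ.- (⁺ 1 ℤ.+ m)) ℤ.* (⁺ 1 ℤ.+ s) ℤ.- ⁺ 1) ℤ.+ (⁺ 1 ℤ.+ m) ℤ.* (⁺ 1 ℤ.+ (q ℤ.+ s))
      lem = ℤ-solve

    term-vanish : ∀ i s (β : Laurent F) → DegLe s dP′ →
      act (term-den i) (lc β) ≐ embed F (mulP F s (scale i)) → VanishAbove (lc β) (bound (ℤ.suc i))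
    term-vanish i s β ds hβ =
      vanish-from-act (term-den i) (deg-term-den i) (lc β) (bound (ℤ.suc i)) _ (term-den-degree i) (bounded-lc β)
        (vanish-cong (≐-sym hβ) (vanish-embed _ _ (mulP-deg s (scale i) dP′ (deg-scale i) ds (proj₂ (scale-degree i)))))
        (term-degrees i)

    digit-degree : ∀ i s (β : Laurent F) → act (term-den i) (lc β) ≐ embed F (mulP F s (scale i)) →
      VanishAbove (lc β) (bound (ℤ.suc i)) → DegLe s dP′
    digit-degree i s β hβ bβ = degLe-from-vanish s dP′
      (vanish-from-act (scale i) (deg-scale i) (embed F s) (⁺ dP′) _ (scale-degree i) (bounded-embed s)
        (vanish-cong (≐-trans hβ (≐-trans (embed-mulP-comm s (scale i)) (≐-sym (act-embed (scale i) s))))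
          (subst (VanishAbove (act (term-den i) (lc β))) (sym (term-degrees i))
            (act-vanish (term-den i) (deg-term-den i) (lc β) _ (proj₂ (term-den-degree i)) bβ)))
        (ℤP.pos-+ dP′ (deg-scale i)))

    record Approximation (α : Laurent F) (t : ℤ) (W : Pol) (Z : Seq) : Set where
      field
        relation : act (den t) Z ≐ act (num t) (embed F W)
        close    : VanishAbove (lc α -S Z) (bound t)
        bounded  : Bounded Z

    -- The polynomial part of an approximation is determined by α and t: num t · (W - W′)
    -- equals den t · (Z - Z′), which vanishes above bound t + deg den t = deg num t - 1.
    approximation-unique : ∀ α t {W W′ Z Z′} → Approximation α t W Z → Approximation α t W′ Z′ → _≈P_ F W W′
    approximation-unique α t {W} {W′} {Z} {Z′} A A′ n = sub≡0⇒≡ _ _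
      (vanish-from-act (num t) (deg-num t) (embed F W -S embed F W′) -[1+ 0 ] _ (num-degree t)
        (bounded--S (bounded-embed W) (bounded-embed W′))
        (vanish-cong (≐-sym product≐) (act-vanish (den t) (deg-den t) (Z -S Z′) (bound t) (proj₂ (den-degree t)) Z-Z′-vanish))
        (trans (lem (t ℤ.* e) (⁺ deg-den t)) (cong (λ z → -[1+ 0 ] ℤ.+ z) (sym (deg-num≡ t))))
        (⁺ n) ℤ.-<+)
      where
      open Approximation
      open ≐-Reasoning
      lem : ∀ x d → (x ℤ.- ⁺ 1) ℤ.+ d ≡ ℤ.- ⁺ 1 ℤ.+ (d ℤ.+ x)
      lem = ℤ-solve
      Z-Z′-vanish : VanishAbove (Z -S Z′) (bound t)
      Z-Z′-vanish j p = trans (sym (sub-sub-cancel (lc α j) (Z j) (Z′ j)))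
                              (trans (cong₂ (λ u v → u + - v) (close A′ j p) (close A j p)) 0-0≡0)
      product≐ : act (num t) (embed F W -S embed F W′) ≐ act (den t) (Z -S Z′)
      product≐ = begin
          act (num t) (embed F W -S embed F W′)
        ≐⟨ act--S (num t) (embed F W) (embed F W′) ⟩
          act (num t) (embed F W) -S act (num t) (embed F W′)
        ≐⟨ -S-cong (≐-sym (relation A)) (≐-sym (relation A′)) ⟩
          act (den t) Z -S act (den t) Z′
        ≐⟨ ≐-sym (act--S (den t) Z Z′) ⟩
          act (den t) (Z -S Z′) ∎

    index : ℕ → ℕ → ℤ
    index k n = ⁺ k ℤ.- ⁺ n

    index-suc : ∀ k n → ℤ.suc (index k (suc n)) ≡ index k n
    index-suc k n = lem (⁺ k) (⁺ n)
      where
      lem : ∀ k n → ⁺ 1 ℤ.+ (k ℤ.- (⁺ 1 ℤ.+ n)) ≡ k ℤ.- n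
      lem = ℤ-solve

    -- Existence: the approximations obtained by long division yield an expansion.

    module Existence (α : Laurent F) where
      τ = top α

      -- y t = den t · α / num t,  which vanishes above τ + deg den t - deg num t = τ - t e
      y-division : ∀ t →
        Σ[ y ∈ Seq ] (VanishAbove y (τ ℤ.+ ⁺ deg-den t ℤ.- ⁺ deg-num t) × act (num t) y ≐ act (den t) (lc α))
      y-division t = divide (num t) (deg-num t) (act (den t) (lc α)) (τ ℤ.+ ⁺ deg-den t) (num-degree t)
                       (act-vanish (den t) (deg-den t) (lc α) τ (proj₂ (den-degree t)) (vanish-lc α))

      y : ℤ → Seq
      y t = proj₁ (y-division t)

      W : ℤ → Pol
      W t = tab F (suc ℤ.∣ τ ℤ.+ ⁺ deg-den t ℤ.- ⁺ deg-num t ∣) (λ n → y t (⁺ n))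

      coeff-W : ∀ t n → cf (W t) n ≡ y t (⁺ n)
      coeff-W t n with n ℕP.<? suc ℤ.∣ τ ℤ.+ ⁺ deg-den t ℤ.- ⁺ deg-num t ∣
      ... | yes p = coeff-tab-< _ _ n p
      ... | no p = trans (coeff-tab-≥ _ _ n (ℕP.≮⇒≥ p))
                         (sym (proj₁ (proj₂ (y-division t)) (⁺ n) (ℤP.≤-<-trans (≤-∣∣ _) (ℤ.+<+ (ℕP.≮⇒≥ p)))))

      fraction-vanish : ∀ t → VanishAbove (y t -S embed F (W t)) -[1+ 0 ]
      fraction-vanish t (⁺ n) p = trans (cong (λ z → y t (⁺ n) + - z) (coeff-W t n)) (-‿inverseʳ _)
      fraction-vanish t -[1+ n ] (ℤ.-<- ())

      Z-division : ∀ t → Σ[ Z ∈ Seq ] (VanishAbove Z _ × act (den t) Z ≐ act (num t) (embed F (W t)))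
      Z-division t = divide (den t) (deg-den t) (act (num t) (embed F (W t))) (⁺ length (W t) ℤ.+ ⁺ deg-num t) (den-degree t)
                       (act-vanish (num t) (deg-num t) (embed F (W t)) (⁺ length (W t)) (proj₂ (num-degree t))
                                   (proj₂ (bounded-embed (W t))))

      Z : ℤ → Seq
      Z t = proj₁ (Z-division t)

      -- den t · (α - Z t) = num t · (y t - W t) has degree < deg num t, so α - Z t vanishes above t e - 1
      approximation : ∀ t → Approximation α t (W t) (Z t)
      approximation t = record
        { relation = proj₂ (proj₂ (Z-division t))
        ; close = vanish-from-act (den t) (deg-den t) (lc α -S Z t) (bound t) _ (den-degree t)
                    (bounded--S (bounded-lc α) Z-bounded)
                    (vanish-cong (≐-sym product≐)
                      (act-vanish (num t) (deg-num t) (y t -S embed F (W t)) -[1+ 0 ] (proj₂ (num-degree t)) (fraction-vanish t)))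
                    (trans (cong (λ z → -[1+ 0 ] ℤ.+ z) (deg-num≡ t)) (lem (⁺ deg-den t) (t ℤ.* e)))
        ; bounded = Z-bounded }
        where
        open ≐-Reasoning
        Z-bounded = _ , proj₁ (proj₂ (Z-division t))
        lem : ∀ d x → ℤ.- ⁺ 1 ℤ.+ (d ℤ.+ x) ≡ (x ℤ.- ⁺ 1) ℤ.+ d
        lem = ℤ-solve
        product≐ : act (den t) (lc α -S Z t) ≐ act (num t) (y t -S embed F (W t))
        product≐ = begin
            act (den t) (lc α -S Z t)
          ≐⟨ act--S (den t) (lc α) (Z t) ⟩
            act (den t) (lc α) -S act (den t) (Z t)
          ≐⟨ -S-cong (≐-sym (proj₂ (proj₂ (y-division t)))) (proj₂ (proj₂ (Z-division t))) ⟩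
            act (num t) (y t) -S act (num t) (embed F (W t))
          ≐⟨ ≐-sym (act--S (num t) (y t) (embed F (W t))) ⟩
            act (num t) (y t -S embed F (W t)) ∎

      open Approximation

      W-vanish : ∀ t → τ ℤ.< t ℤ.* e → _≈P_ F (W t) []
      W-vanish t p n = trans (coeff-W t n)
        (proj₁ (proj₂ (y-division t)) (⁺ n) (ℤP.<-≤-trans y-top<0 (ℤ.+≤+ z≤n)))
        where
        lem : ∀ τ d x → τ ℤ.+ d ℤ.- (d ℤ.+ x) ≡ τ ℤ.- x
        lem = ℤ-solve
        y-top<0 : τ ℤ.+ ⁺ deg-den t ℤ.- ⁺ deg-num t ℤ.< ⁺ 0
        y-top<0 = subst (ℤ._< ⁺ 0) (sym (trans (cong (λ z → τ ℤ.+ ⁺ deg-den t ℤ.- z) (deg-num≡ t)) (lem τ _ _)))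
                        (sub-negative p)

      k : ℕ
      k = ℤ.∣ τ ∣

      ix : ℕ → ℤ
      ix = index k

      vertex : ℕ → Pol
      vertex n = W (ℤ.suc (ix n))

      word : ℕ → Pol
      word n = addP F (mulP F Q (W (ix n))) (negP (mulP F P (vertex n)))

      -- the path starts at 0: W (k + 1) = 0 because τ ≤ k < (k + 1) e
      τ<[k+1]e : τ ℤ.< ℤ.suc (ix 0) ℤ.* e
      τ<[k+1]e = ℤP.≤-<-trans (≤-∣∣ τ) (<-from-witness (suc k ℕ.* e′)
        (trans (lem (⁺ k) (⁺ e′)) (cong (λ z → (⁺ k ℤ.+ z) ℤ.+ ⁺ 1) (sym (ℤP.pos-* (suc k) e′)))))
        where
        lem : ∀ k f → (⁺ 1 ℤ.+ (k ℤ.- ⁺ 0)) ℤ.* (⁺ 1 ℤ.+ f) ≡ (k ℤ.+ (⁺ 1 ℤ.+ k) ℤ.* f) ℤ.+ ⁺ 1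
        lem = ℤ-solve

      vertex-zero : _≈P_ F (vertex 0) []
      vertex-zero = W-vanish (ℤ.suc (ix 0)) τ<[k+1]e

      Z-top-zero : Z (ℤ.suc (ix 0)) ≐ 0S
      Z-top-zero = act-injective (den t₀) (deg-den t₀) {Z t₀} {0S} (den-degree t₀)
                     (bounded (approximation t₀)) (⁺ 0 , λ _ _ → refl) (begin
          act (den t₀) (Z t₀)
        ≐⟨ relation (approximation t₀) ⟩
          act (num t₀) (embed F (W t₀))
        ≐⟨ act-congʳ (num t₀) (≐-trans (embed-cong _ _ vertex-zero) embed-nil) ⟩
          act (num t₀) 0S
        ≐⟨ ≐-trans (act-0S (num t₀)) (≐-sym (act-0S (den t₀))) ⟩
          act (den t₀) 0S ∎)
        where
        open ≐-Reasoning
        t₀ = ℤ.suc (ix 0)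

      label-edge : ∀ n → _≈P_ F (mulP F Q (W (ix n))) (addP F (mulP F P (vertex n)) (word n))
      label-edge n m = sym (begin
          cf (addP F (mulP F P (vertex n)) (word n)) m
        ≡⟨ coeff-addP (mulP F P (vertex n)) (word n) m ⟩
          cf (mulP F P (vertex n)) m + cf (word n) m
        ≡⟨ cong (cf (mulP F P (vertex n)) m +_)
                (trans (coeff-addP (mulP F Q (W (ix n))) (negP (mulP F P (vertex n))) m)
                       (cong (cf (mulP F Q (W (ix n))) m +_) (coeff-negP (mulP F P (vertex n)) m))) ⟩
          cf (mulP F P (vertex n)) m + (cf (mulP F Q (W (ix n))) m + - cf (mulP F P (vertex n)) m)
        ≡⟨ add-sub-cancel _ _ ⟩
          cf (mulP F Q (W (ix n))) m ∎)
        where open ≡-Reasoning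

      edge-to-next : ∀ n → _≈P_ F (mulP F Q (vertex (suc n))) (addP F (mulP F P (vertex n)) (word n))
      edge-to-next n = subst (λ t → _≈P_ F (mulP F Q (W t)) (addP F (mulP F P (vertex n)) (word n)))
                             (sym (index-suc k n)) (label-edge n)

      β : ℕ → Laurent F
      β n = record { lc = Z (ix n) -S Z (ℤ.suc (ix n))
                   ; top = proj₁ bounds
                   ; vanish = proj₂ bounds }
        where bounds = bounded--S (bounded (approximation (ix n))) (bounded (approximation (ℤ.suc (ix n))))

      β-term : ∀ n → act (term-den (ix n)) (lc (β n)) ≐ embed F (mulP F (word n) (scale (ix n)))
      β-term n = difference-is-term (ix n) {vertex n} {W (ix n)} {word n} {Z (ℤ.suc (ix n))} {Z (ix n)}
                                    (relation (approximation (ℤ.suc (ix n)))) (relation (approximation (ix n)))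
                                    (label-edge n)

      -- β n = (α - Z (k - n + 1)) - (α - Z (k - n)) vanishes above bound (k - n + 1)
      β-vanish : ∀ n → VanishAbove (lc (β n)) (bound (ℤ.suc (ix n)))
      β-vanish n j p = trans (sym (sub-sub-cancel (lc α j) (Z (ix n) j) (Z (ℤ.suc (ix n)) j)))
        (trans (cong₂ (λ u v → u + - v) (close (approximation (ℤ.suc (ix n))) j p)
                                         (close (approximation (ix n)) j (ℤP.≤-<-trans bound≤ p)))
               0-0≡0)
        where bound≤ = bound-mono (ℤP.i≤suc[i] (ix n))

      -- the partial sums telescope to Z (k - N + 1) - Z (k + 1) = Z (k - N + 1)
      partial-sum : ∀ N j → ∑ N (λ n → lc (β n) j) ≡ Z (ℤ.suc (ix N)) j
      partial-sum zero j = trans (sym (-‿inverseʳ _)) (trans (cong (λ z → Z (ℤ.suc (ix 0)) j + - z) (app Z-top-zero j))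
                                                              (trans (cong (Z (ℤ.suc (ix 0)) j +_) -0#≈0#) (+-identityʳ _)))
      partial-sum (suc N) j = begin
          ∑ N (λ n → lc (β n) j) + (Z (ix N) j + - Z (ℤ.suc (ix N)) j)
        ≡⟨ cong (_+ (Z (ix N) j + - Z (ℤ.suc (ix N)) j)) (partial-sum N j) ⟩
          Z (ℤ.suc (ix N)) j + (Z (ix N) j + - Z (ℤ.suc (ix N)) j)
        ≡⟨ add-sub-cancel _ _ ⟩
          Z (ix N) j
        ≡⟨ cong (λ t → Z t j) (sym (index-suc k N)) ⟩
          Z (ℤ.suc (ix (suc N))) j ∎
        where open ≡-Reasoning

      level-below : ∀ N M → suc k ℕ.+ M ≤ N → ℤ.suc (ix N) ℤ.≤ ℤ.- ⁺ M
      level-below N M p = ≤-from-witness (N ∸ (suc k ℕ.+ M))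
        (trans (lem (⁺ k) (⁺ M) (⁺ (N ∸ (suc k ℕ.+ M))))
               (cong (λ z → ⁺ 1 ℤ.+ (⁺ k ℤ.- z) ℤ.+ ⁺ (N ∸ (suc k ℕ.+ M))) N≡))
        where
        lem : ∀ k M x → ℤ.- M ≡ ⁺ 1 ℤ.+ (k ℤ.- (((⁺ 1 ℤ.+ k) ℤ.+ M) ℤ.+ x)) ℤ.+ x
        lem = ℤ-solve
        N≡ : ((⁺ 1 ℤ.+ ⁺ k) ℤ.+ ⁺ M) ℤ.+ ⁺ (N ∸ (suc k ℕ.+ M)) ≡ ⁺ N
        N≡ = trans (cong (ℤ._+ ⁺ (N ∸ (suc k ℕ.+ M))) (sym (ℤP.pos-+ (suc k) M)))
                   (trans (sym (ℤP.pos-+ (suc k ℕ.+ M) _)) (cong ⁺_ (ℕP.m+[n∸m]≡n p)))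

      converges : ConvergesTo F β α
      converges M = suc k ℕ.+ M , λ N p j q →
        trans (sub≡0⇒≡ _ _ (close (approximation (ℤ.suc (ix N))) j
                             (ℤP.<-≤-trans (bound-below _ M (level-below N M p)) q)))
              (sym (partial-sum N j))

      expansion : IsExpansion F P Q dP α k word
      expansion = (vertex , vertex-zero , λ n → digits n , edge-to-next n) ,
                  (β , (λ n → IsTerm⇐ (ix n) (word n) (β n) (β-term n)) , converges)
        where
        digits : ∀ n → InDigits F dP (word n)
        digits n = digit-degree (ix n) (word n) (β n) (β-term n) (β-vanish n)

    -- Uniqueness: the partial sums of any expansion are approximations.

    module Uniqueness (α : Laurent F) (k : ℕ) (w : ℕ → Pol) (ex : IsExpansion F P Q dP α k w) where
      ix : ℕ → ℤ
      ix = index k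

      vertex : ℕ → Pol
      vertex = proj₁ (proj₁ ex)

      edge : ∀ n → Edge F P Q dP (vertex n) (w n) (vertex (suc n))
      edge = proj₂ (proj₂ (proj₁ ex))

      β : ℕ → Laurent F
      β = proj₁ (proj₂ ex)

      term : ∀ n → act (term-den (ix n)) (lc (β n)) ≐ embed F (mulP F (w n) (scale (ix n)))
      term n = IsTerm⇒ (ix n) (w n) (β n) (proj₁ (proj₂ (proj₂ ex)) n)

      partial : ℕ → Seq
      partial N j = ∑ N (λ n → lc (β n) j)

      partial-bounded : ∀ N → Bounded (partial N)
      partial-bounded zero = ⁺ 0 , λ _ _ → refl
      partial-bounded (suc N) = bounded-+S (partial-bounded N) (bounded-lc (β N))

      partial-relation : ∀ N → act (den (ℤ.suc (ix N))) (partial N) ≐ act (num (ℤ.suc (ix N))) (embed F (vertex N))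
      partial-relation zero = ≐-trans (act-0S (den t₀)) (≐-sym (≐-trans (act-congʳ (num t₀) vertex₀≐0) (act-0S (num t₀))))
        where
        t₀ = ℤ.suc (ix 0)
        vertex₀≐0 = ≐-trans (embed-cong (vertex 0) [] (proj₁ (proj₂ (proj₁ ex)))) embed-nil
      partial-relation (suc N) =
        subst (λ t → act (den t) (partial (suc N)) ≐ act (num t) (embed F (vertex (suc N)))) (sym (index-suc k N))
              (add-term (ix N) {vertex N} {vertex (suc N)} {w N} (β N) (partial-bounded N)
                        (partial-relation N) (term N) (proj₂ (edge N)))

      -- β (n + x) vanishes above bound (k - n + 1), hence so do the tails of the series
      tail-vanish : ∀ x n → VanishAbove (partial (x ℕ.+ n) -S partial n) (bound (ℤ.suc (ix n)))
      tail-vanish zero n j p = -‿inverseʳ _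
      tail-vanish (suc x) n j p = begin
          (partial (x ℕ.+ n) j + lc (β (x ℕ.+ n)) j) + - partial n j
        ≡⟨ solve 3 (λ a b c → ((a ⊕ b) ⊕ (⊝ c)) ⊜ ((a ⊕ (⊝ c)) ⊕ b)) refl _ _ _ ⟩
          (partial (x ℕ.+ n) j + - partial n j) + lc (β (x ℕ.+ n)) j
        ≡⟨ cong₂ _+_ (tail-vanish x n j p) (β-vanish j (ℤP.≤-<-trans bound≤ p)) ⟩
          0# + 0#
        ≡⟨ +-identityʳ 0# ⟩
          0# ∎
        where
        open ≡-Reasoning
        β-vanish = term-vanish (ix (x ℕ.+ n)) (w (x ℕ.+ n)) (β (x ℕ.+ n)) (proj₁ (edge (x ℕ.+ n))) (term (x ℕ.+ n))
        bound≤ = bound-mono (ℤP.+-monoʳ-≤ (⁺ 1) (ℤP.+-monoʳ-≤ (⁺ k) (ℤP.neg-mono-≤ (ℤ.+≤+ (ℕP.m≤n+m n x)))))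

      partial-close : ∀ n → VanishAbove (lc α -S partial n) (bound (ℤ.suc (ix n)))
      partial-close n j p = trans (cong (_+ - partial n j) (proj₂ (converges M) (N₀ ℕ.+ n) (ℕP.m≤m+n N₀ n) j (-∣∣-≤ j)))
                                  (tail-vanish N₀ n j p)
        where
        converges = proj₂ (proj₂ (proj₂ ex))
        M = ℤ.∣ j ∣
        N₀ = proj₁ (converges M)

      -- the approximation at level t: partial (k + 1 - t) for t ≤ k + 1, and 0 above
      W-at : ℤ → Pol
      W-at (⁺ n) = vertex n
      W-at -[1+ _ ] = []

      Z-at : ℤ → Seq
      Z-at (⁺ n) = partial n
      Z-at -[1+ _ ] = 0S

      W : ℤ → Pol
      W t = W-at (⁺ (suc k) ℤ.- t)

      Z : ℤ → Seq
      Z t = Z-at (⁺ (suc k) ℤ.- t)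

      level≡ : ∀ t d → ⁺ (suc k) ℤ.- t ≡ d → t ≡ ⁺ (suc k) ℤ.- d
      level≡ t d eq = trans (lem (⁺ (suc k)) t) (cong (λ z → ⁺ (suc k) ℤ.- z) eq)
        where
        lem : ∀ a t → t ≡ a ℤ.- (a ℤ.- t)
        lem = ℤ-solve

      approximation-at : ∀ t d → ⁺ (suc k) ℤ.- t ≡ d → Approximation α t (W-at d) (Z-at d)
      approximation-at t (⁺ n) eq =
        subst (λ t → Approximation α t (vertex n) (partial n)) (sym (trans (level≡ t (⁺ n) eq) (lem (⁺ k) (⁺ n))))
          (record { relation = partial-relation n ; close = partial-close n ; bounded = partial-bounded n })
        where
        lem : ∀ k n → (⁺ 1 ℤ.+ k) ℤ.- n ≡ ⁺ 1 ℤ.+ (k ℤ.- n)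
        lem = ℤ-solve
      approximation-at t -[1+ m ] eq = record
          { relation = ≐-trans (act-0S (den t)) (≐-sym (≐-trans (act-congʳ (num t) embed-nil) (act-0S (num t))))
          ; close = vanish-mono (bound-mono k+1≤t) (partial-close 0)
          ; bounded = ⁺ 0 , λ _ _ → refl }
        where
        lem : ∀ k m → (⁺ 1 ℤ.+ k) ℤ.- ℤ.- (⁺ 1 ℤ.+ m) ≡ (⁺ 1 ℤ.+ (k ℤ.- ⁺ 0)) ℤ.+ (⁺ 1 ℤ.+ m)
        lem = ℤ-solve
        k+1≤t : ℤ.suc (ix 0) ℤ.≤ t
        k+1≤t = ≤-from-witness (suc m) (trans (level≡ t -[1+ m ] eq) (lem (⁺ k) (⁺ m)))

      approximation : ∀ t → Approximation α t (W t) (Z t)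
      approximation t = approximation-at t (⁺ (suc k) ℤ.- t) refl

      digit-at : ℤ → Pol
      digit-at (⁺ n) = w n
      digit-at -[1+ _ ] = []

      digitAt≡ : ∀ i → digitAt F k w i ≡ digit-at (⁺ k ℤ.- i)
      digitAt≡ i with ⁺ k ℤ.- i
      ... | ⁺ n = refl
      ... | -[1+ _ ] = refl

      loop-at-0 : _≈P_ F (addP F (mulP F P []) []) []
      loop-at-0 j = trans (coeff-addP (mulP F P []) [] j) (trans (+-identityʳ _) (mulP-zeroʳ P [] (λ _ → refl) j))

      -- the digit at offset d labels an edge W-at d --s--> W-at (d + 1) of the path extended by loops at 0
      digit-edge-at : ∀ d → _≈P_ F (mulP F Q (W-at (⁺ 1 ℤ.+ d))) (addP F (mulP F P (W-at d)) (digit-at d))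
      digit-edge-at (⁺ n) = proj₂ (edge n)
      digit-edge-at -[1+ zero ] j = trans (mulP-zeroʳ Q (vertex 0) (proj₁ (proj₂ (proj₁ ex))) j) (sym (loop-at-0 j))
      digit-edge-at -[1+ suc m ] j = trans (mulP-zeroʳ Q [] (λ _ → refl) j) (sym (loop-at-0 j))

      digit-value : ∀ i j → cf (digitAt F k w i) j ≡ cf (mulP F Q (W i)) j + - cf (mulP F P (W (ℤ.suc i))) j
      digit-value i j = sym (sub-from-sum _ _ _ (trans edge≡ (coeff-addP (mulP F P (W (ℤ.suc i))) (digitAt F k w i) j)))
        where
        lem₁ : ∀ k i → (⁺ 1 ℤ.+ k) ℤ.- (⁺ 1 ℤ.+ i) ≡ k ℤ.- i
        lem₁ = ℤ-solve
        lem₂ : ∀ k i → (⁺ 1 ℤ.+ k) ℤ.- i ≡ ⁺ 1 ℤ.+ (k ℤ.- i)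
        lem₂ = ℤ-solve
        edge≡ : cf (mulP F Q (W i)) j ≡ cf (addP F (mulP F P (W (ℤ.suc i))) (digitAt F k w i)) j
        edge≡ = subst₂ (λ a b → cf (mulP F Q (W-at a)) j ≡ cf (addP F (mulP F P (W-at b)) (digitAt F k w i)) j)
                       (sym (lem₂ (⁺ k) i)) (sym (lem₁ (⁺ k) i))
                       (subst (λ s → cf (mulP F Q (W-at (⁺ 1 ℤ.+ (⁺ k ℤ.- i)))) j ≡
                                     cf (addP F (mulP F P (W-at (⁺ k ℤ.- i))) s) j)
                              (sym (digitAt≡ i)) (digit-edge-at (⁺ k ℤ.- i) j))

    -- two expansions of α have the same digits: both are Q W i - P W (i + 1), and the
    -- polynomial parts W of their level-i approximations coincide
    digits-unique : ∀ α k k′ w w′ → IsExpansion F P Q dP α k w → IsExpansion F P Q dP α k′ w′ →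
      ∀ i → _≈P_ F (digitAt F k w i) (digitAt F k′ w′ i)
    digits-unique α k k′ w w′ ex ex′ i j = begin
        cf (digitAt F k w i) j
      ≡⟨ U.digit-value i j ⟩
        cf (mulP F Q (U.W i)) j + - cf (mulP F P (U.W (ℤ.suc i))) j
      ≡⟨ cong₂ (λ a b → a + - b) (mulP-congʳ Q (U.W i) (U′.W i) (same-W i) j)
                                 (mulP-congʳ P (U.W (ℤ.suc i)) (U′.W (ℤ.suc i)) (same-W (ℤ.suc i)) j) ⟩
        cf (mulP F Q (U′.W i)) j + - cf (mulP F P (U′.W (ℤ.suc i))) j
      ≡⟨ sym (U′.digit-value i j) ⟩
        cf (digitAt F k′ w′ i) j ∎
      where
      open ≡-Reasoning
      module U = Uniqueness α k w ex
      module U′ = Uniqueness α k′ w′ ex′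
      same-W : ∀ t → _≈P_ F (U.W t) (U′.W t)
      same-W t = approximation-unique α t (U.approximation t) (U′.approximation t)

-- Theorem 5.4 (deg Q < deg P forces deg P = 1 + dP′).
theorem5p4 : (F : FiniteField) (P Q : Poly F) (dP dQ : ℕ) →
    HasDegree F P dP → HasDegree F Q dQ → dQ < dP → Coprime F P Q →
    (α : Laurent F) →
    (∃ λ (k : ℕ) → ∃ λ (word : ℕ → Poly F) → IsExpansion F P Q dP α k word) ×
    (∀ (k k′ : ℕ) (word word′ : ℕ → Poly F) →
      IsExpansion F P Q dP α k word → IsExpansion F P Q dP α k′ word′ →
      ∀ (i : ℤ) → _≈P_ F (digitAt F k word i) (digitAt F k′ word′ i))
theorem5p4 F P Q zero dQ hP hQ () _ α
theorem5p4 F P Q (suc dP′) dQ hP hQ (s≤s dQ≤dP′) _ α =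
  (k , word , expansion) , digits-unique α
  where
  open Development.Expansions F P Q dP′ dQ hP hQ dQ≤dP′
  open Existence α
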